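{- For a visibility graph $G$, the following are equivalent: (1) $\kappa(G)\ge 3$; (2) $\lambda(G)\ge 3$; (3) $\delta(G)\ge 3$.
   Context: For a finite set $P$ of points in the plane, two distinct points $v,w$ are visible with respect to $P$ if no point of $P$ lies in the open line segment $vw$. The visibility graph of $P$ has vertex set $P$, with $v,w$ adjacent iff they are visible with respect to $P$. $\kappa$, $\lambda$, $\delta$ denote vertex-connectivity, edge-connectivity and minimum degree. -}

module Defs where

open import Level using (0ℓ)
open import Data.Nat using (ℕ; _≤_)
open import Data.Fin using (Fin)
open import Data.List using (List; length)
open import Data.List.Membership.Propositional using (_∈_; _∉_)
open import Data.Product using (Σ; ∃; _×_; _,_)
open import Data.Sum using (_⊎_)
open import Data.Unit using (⊤)
open import Relation.Nullary using (¬_)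
open import Relation.Binary.PropositionalEquality using (_≡_; _≢_)

-- The real numbers, given axiomatically as a complete ordered field
-- (unique up to isomorphism; the stdlib has no reals).

record CompleteOrderedField : Set₁ where
  infixl 6 _+_ _-_
  infixl 7 _*_
  infix 4 _<_ _≤ᵣ_
  field
    Carrier : Set
    0# 1#   : Carrier
    _+_ _*_ : Carrier → Carrier → Carrier
    -_      : Carrier → Carrier
    _<_     : Carrier → Carrier → Set
    +-assoc     : ∀ x y z → (x + y) + z ≡ x + (y + z)
    +-comm      : ∀ x y → x + y ≡ y + x
    +-identityˡ : ∀ x → 0# + x ≡ x
    +-inverseˡ  : ∀ x → (- x) + x ≡ 0#
    *-assoc     : ∀ x y z → (x * y) * z ≡ x * (y * z)
    *-comm      : ∀ x y → x * y ≡ y * x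
    *-identityˡ : ∀ x → 1# * x ≡ x
    distribˡ    : ∀ x y z → x * (y + z) ≡ (x * y) + (x * z)
    0≢1         : 0# ≢ 1#
    *-inverse   : ∀ x → x ≢ 0# → ∃ λ y → y * x ≡ 1#
    <-irrefl    : ∀ x → ¬ (x < x)
    <-trans     : ∀ {x y z} → x < y → y < z → x < z
    <-trichotomy : ∀ x y → x < y ⊎ x ≡ y ⊎ y < x
    +-mono-<    : ∀ {x y} z → x < y → x + z < y + z
    *-pos       : ∀ {x y} → 0# < x → 0# < y → 0# < x * y
    lub : (S : Carrier → Set) → (∃ λ s → S s) →
          (∃ λ b → ∀ s → S s → (s < b ⊎ s ≡ b)) →
          ∃ λ u → (∀ s → S s → (s < u ⊎ s ≡ u)) ×
                  (∀ b → (∀ s → S s → (s < b ⊎ s ≡ b)) → (u < b ⊎ u ≡ b))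

  _-_ : Carrier → Carrier → Carrier
  x - y = x + (- y)

  _≤ᵣ_ : Carrier → Carrier → Set
  x ≤ᵣ y = x < y ⊎ x ≡ y

module _ (R : CompleteOrderedField) where
  open CompleteOrderedField R

  Point : Set
  Point = Carrier × Carrier

  InOpenSegment : Point → Point → Point → Set
  InOpenSegment (vx , vy) (wx , wy) (rx , ry) =
    ∃ λ t → (0# < t) × (t < 1#) ×
            (rx ≡ vx + t * (wx - vx)) × (ry ≡ vy + t * (wy - vy))

  -- visibility graph of the point set P = {p i | i : Fin n}
  -- (p injective, so the vertex set Fin n is in bijection with P)
  VisAdj : ∀ {n} → (Fin n → Point) → Fin n → Fin n → Set
  VisAdj {n} p i j = (i ≢ j) × (∀ (k : Fin n) → ¬ InOpenSegment (p i) (p j) (p k))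

module _ {n : ℕ} (Adj : Fin n → Fin n → Set) where

  -- walks using only allowed vertices (after the start) and allowed edges
  data Walk (OkV : Fin n → Set) (OkE : Fin n → Fin n → Set) : Fin n → Fin n → Set where
    here : ∀ {u} → Walk OkV OkE u u
    step : ∀ {u v w} → Adj u v → OkE u v → OkV v → Walk OkV OkE v w → Walk OkV OkE u w

  VertexConn≥3 : Set
  VertexConn≥3 = (4 ≤ n) ×
    (∀ (S : List (Fin n)) → length S ≤ 2 → ∀ u v → u ∉ S → v ∉ S →
      Walk (λ x → x ∉ S) (λ _ _ → ⊤) u v)

  EdgeConn≥3 : Set
  EdgeConn≥3 = (2 ≤ n) ×
    (∀ (F : List (Fin n × Fin n)) → length F ≤ 2 → ∀ u v →
      Walk (λ _ → ⊤) (λ x y → ((x , y) ∉ F) × ((y , x) ∉ F)) u v)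

  MinDegree≥3 : Set
  MinDegree≥3 = ∀ v → ∃ λ a → ∃ λ b → ∃ λ c →
    Adj v a × Adj v b × Adj v c × (a ≢ b) × (a ≢ c) × (b ≢ c)

module Submission where

-- In every graph κ ≥ 3 gives λ ≥ 3 (a deleted edge other than uv is bypassed
-- by deleting one of its endpoints; if uv itself is deleted, leave u along
-- another edge and then avoid u) and λ ≥ 3 gives δ ≥ 3. The geometry is in
-- δ ≥ 3 ⇒ κ ≥ 3. To join u and v avoiding x and y, walk along the segment uv
-- through every point on it, unless it contains x (or y). Not all points but y
-- lie on the line uv, since the extreme point of that line would see at most
-- one other point of it; so some w ∉ {x, y} is off the line, and the route
-- u → w → v along segments misses x. If y lies on it, say in (u, w), leave u
-- towards a neighbour b ∉ {x, y} and continue to v directly or via w: signs of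
-- orientations show that one of these routes misses both x and y.

open import Defs
open import Level using (0ℓ)
open import Algebra.Bundles using (RawRing; CommutativeRing)
open import Algebra.Solver.Ring.AlmostCommutativeRing using (_-Raw-AlmostCommutative⟶_; fromCommutativeRing)
open import Data.Bool using (T)
open import Data.Empty using (⊥; ⊥-elim)
open import Data.Fin using (Fin; zero; suc; fromℕ<)
import Data.Fin.Properties as Fin
open import Data.List using (List; []; _∷_; length; _++_; lookup)
open import Data.List.Membership.Propositional using (_∈_; _∉_)
open import Data.List.Membership.Propositional.Properties using (∈-++⁺ˡ; ∈-++⁺ʳ; ∈-++⁻)
open import Data.List.Properties using (length-++)
open import Data.List.Relation.Unary.Any using (here; there; index)
import Data.List.Relation.Unary.Any as Any
open import Data.List.Relation.Unary.Any.Properties using (lookup-index)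
open import Data.Maybe using (Maybe; just; nothing; is-just)
open import Data.Nat using (ℕ; zero; suc; _≤_; z≤n; s≤s)
import Data.Nat as ℕ
import Data.Nat.Properties as ℕ
open import Data.Product using (_×_; _,_; proj₁; proj₂; ∃; ∃₂; swap)
open import Data.Sum using (_⊎_; inj₁; inj₂; [_,_]′)
open import Data.Unit using (⊤; tt)
open import Data.Vec using ([]; _∷_; allFin)
import Data.Vec as Vec
open import Data.Vec.N-ary using (N-ary; _$ⁿ_)
import Data.Vec.Relation.Unary.All as All
import Data.Vec.Relation.Unary.AllPairs as AllPairs
open import Data.Vec.Relation.Unary.Unique.Propositional.Properties using (lookup-injective)
open import Function using (_∘_)
open import Function.Definitions using (Injective)
open import Function.Bundles using (_⇔_; mk⇔)
open import Relation.Binary.PropositionalEquality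
  using (_≡_; _≢_; refl; sym; trans; cong; cong₂; subst; subst₂; isEquivalence; module ≡-Reasoning)
open import Relation.Nullary using (¬_; Dec; yes; no; ¬?; _×-dec_)

module IntegerCoefficientSolver {c ℓ} (CR : CommutativeRing c ℓ) where

  open CommutativeRing CR renaming (refl to ≈-refl; sym to ≈-sym; trans to ≈-trans)
  open import Algebra.Properties.Semiring.Mult.TCOptimised semiring
    using (×-homo-+; ×1-homo-*) renaming (_×_ to _·_)
  open import Algebra.Properties.Ring ring
    using (-0#≈0#; -‿+-comm; ⁻¹-anti-homo‿-; x[y-z]≈xy-xz; [y-z]x≈yx-zx)
  open import Algebra.Properties.CommutativeSemigroup +-commutativeSemigroup
    using (interchange)
  open import Relation.Binary.Reasoning.Setoid setoid

  -- The coefficient (a , b) stands for the integer a - b.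
  ℕ²-rawRing : RawRing 0ℓ 0ℓ
  ℕ²-rawRing = record
    { Carrier = ℕ × ℕ ; _≈_ = _≡_
    ; _+_ = λ { (a , b) (c , d) → (a ℕ.+ c , b ℕ.+ d) }
    ; _*_ = λ { (a , b) (c , d) → (a ℕ.* c ℕ.+ b ℕ.* d , a ℕ.* d ℕ.+ b ℕ.* c) }
    ; -_ = λ { (a , b) → (b , a) }
    ; 0# = (0 , 0) ; 1# = (1 , 0) }

  ι : ℕ → Carrier
  ι n = n · 1#

  -- Split on b so that the constants (0 , 0) and (1 , 0) denote 0# and
  -- 1# definitionally.
  ⟦_⟧ᶜ : ℕ × ℕ → Carrier
  ⟦ a , zero ⟧ᶜ = ι a
  ⟦ a , suc b ⟧ᶜ = ι a - ι (suc b)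

  ⟦⟧ᶜ≈ι-ι : ∀ a b → ⟦ a , b ⟧ᶜ ≈ ι a - ι b
  ⟦⟧ᶜ≈ι-ι a zero = begin
    ι a        ≈⟨ +-identityʳ (ι a) ⟨
    ι a + 0#   ≈⟨ +-congˡ -0#≈0# ⟨
    ι a - 0#   ∎
  ⟦⟧ᶜ≈ι-ι a (suc b) = ≈-refl

  ι-+ : ∀ a b → ι (a ℕ.+ b) ≈ ι a + ι b
  ι-+ = ×-homo-+ 1#

  ι-* : ∀ a b → ι (a ℕ.* b) ≈ ι a * ι b
  ι-* = ×1-homo-*

  ⟦⟧ᶜ-+ : ∀ x y → ⟦ RawRing._+_ ℕ²-rawRing x y ⟧ᶜ ≈ ⟦ x ⟧ᶜ + ⟦ y ⟧ᶜ
  ⟦⟧ᶜ-+ (a , b) (c , d) = begin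
    ⟦ a ℕ.+ c , b ℕ.+ d ⟧ᶜ         ≈⟨ ⟦⟧ᶜ≈ι-ι (a ℕ.+ c) (b ℕ.+ d) ⟩
    ι (a ℕ.+ c) - ι (b ℕ.+ d)       ≈⟨ +-cong (ι-+ a c) (-‿cong (ι-+ b d)) ⟩
    (ι a + ι c) - (ι b + ι d)       ≈⟨ +-congˡ (-‿+-comm (ι b) (ι d)) ⟨
    (ι a + ι c) + (- ι b + - ι d)   ≈⟨ interchange _ _ _ _ ⟩
    (ι a - ι b) + (ι c - ι d)       ≈⟨ +-cong (⟦⟧ᶜ≈ι-ι a b) (⟦⟧ᶜ≈ι-ι c d) ⟨
    ⟦ a , b ⟧ᶜ + ⟦ c , d ⟧ᶜ         ∎

  ⟦⟧ᶜ-* : ∀ x y → ⟦ RawRing._*_ ℕ²-rawRing x y ⟧ᶜ ≈ ⟦ x ⟧ᶜ * ⟦ y ⟧ᶜ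
  ⟦⟧ᶜ-* (a , b) (c , d) = begin
    ⟦ a ℕ.* c ℕ.+ b ℕ.* d , a ℕ.* d ℕ.+ b ℕ.* c ⟧ᶜ
      ≈⟨ ⟦⟧ᶜ≈ι-ι (a ℕ.* c ℕ.+ b ℕ.* d) (a ℕ.* d ℕ.+ b ℕ.* c) ⟩
    ι (a ℕ.* c ℕ.+ b ℕ.* d) - ι (a ℕ.* d ℕ.+ b ℕ.* c)
      ≈⟨ +-cong (≈-trans (ι-+ (a ℕ.* c) (b ℕ.* d)) (+-cong (ι-* a c) (ι-* b d)))
                (-‿cong (≈-trans (ι-+ (a ℕ.* d) (b ℕ.* c))
                                 (≈-trans (+-cong (ι-* a d) (ι-* b c)) (+-comm _ _)))) ⟩
    (A * C + B * D) - (B * C + A * D)        ≈⟨ +-congˡ (-‿+-comm (B * C) (A * D)) ⟨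
    (A * C + B * D) + (- (B * C) + - (A * D)) ≈⟨ interchange _ _ _ _ ⟩
    (A * C - B * C) + (B * D - A * D)        ≈⟨ +-congˡ (⁻¹-anti-homo‿- (A * D) (B * D)) ⟨
    (A * C - B * C) - (A * D - B * D)        ≈⟨ +-cong ([y-z]x≈yx-zx C A B) (-‿cong ([y-z]x≈yx-zx D A B)) ⟨
    (A - B) * C - (A - B) * D                ≈⟨ x[y-z]≈xy-xz (A - B) C D ⟨
    (A - B) * (C - D)                        ≈⟨ *-cong (⟦⟧ᶜ≈ι-ι a b) (⟦⟧ᶜ≈ι-ι c d) ⟨
    ⟦ a , b ⟧ᶜ * ⟦ c , d ⟧ᶜ                  ∎
    where
    A = ι a ; B = ι b ; C = ι c ; D = ι d

  ⟦⟧ᶜ-‿ : ∀ x → ⟦ RawRing.-_ ℕ²-rawRing x ⟧ᶜ ≈ - ⟦ x ⟧ᶜ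
  ⟦⟧ᶜ-‿ (a , b) = begin
    ⟦ b , a ⟧ᶜ     ≈⟨ ⟦⟧ᶜ≈ι-ι b a ⟩
    ι b - ι a      ≈⟨ ⁻¹-anti-homo‿- (ι a) (ι b) ⟨
    - (ι a - ι b)  ≈⟨ -‿cong (⟦⟧ᶜ≈ι-ι a b) ⟨
    - ⟦ a , b ⟧ᶜ   ∎

  difference-cong : ∀ x y z w → x + w ≈ z + y → x - y ≈ z - w
  difference-cong x y z w eq = begin
    x - y                  ≈⟨ +-identityʳ (x - y) ⟨
    (x - y) + 0#           ≈⟨ +-congˡ (-‿inverseʳ w) ⟨
    (x - y) + (w - w)      ≈⟨ interchange x (- y) w (- w) ⟩
    (x + w) + (- y - w)    ≈⟨ +-cong eq (+-comm (- y) (- w)) ⟩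
    (z + y) + (- w - y)    ≈⟨ interchange z y (- w) (- y) ⟩
    (z - w) + (y - y)      ≈⟨ +-congˡ (-‿inverseʳ y) ⟩
    (z - w) + 0#           ≈⟨ +-identityʳ (z - w) ⟩
    z - w                  ∎

  homomorphism : ℕ²-rawRing -Raw-AlmostCommutative⟶ fromCommutativeRing CR
  homomorphism = record
    { ⟦_⟧ = ⟦_⟧ᶜ ; +-homo = ⟦⟧ᶜ-+ ; *-homo = ⟦⟧ᶜ-* ; -‿homo = ⟦⟧ᶜ-‿
    ; 0-homo = ≈-refl ; 1-homo = ≈-refl }

  _≟ᶜ_ : ∀ x y → Maybe (⟦ x ⟧ᶜ ≈ ⟦ y ⟧ᶜ)
  (a , b) ≟ᶜ (c , d) with a ℕ.+ d ℕ.≟ c ℕ.+ b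
  ... | no _ = nothing
  ... | yes eq = just (begin
    ⟦ a , b ⟧ᶜ  ≈⟨ ⟦⟧ᶜ≈ι-ι a b ⟩
    ι a - ι b   ≈⟨ difference-cong _ _ _ _ ι-eq ⟩
    ι c - ι d   ≈⟨ ⟦⟧ᶜ≈ι-ι c d ⟨
    ⟦ c , d ⟧ᶜ  ∎)
    where
    ι-eq : ι a + ι d ≈ ι c + ι b
    ι-eq = ≈-trans (≈-sym (ι-+ a d)) (≈-trans (reflexive (cong ι eq)) (ι-+ c b))

  open import Algebra.Solver.Ring ℕ²-rawRing (fromCommutativeRing CR) homomorphism _≟ᶜ_ public

  :0 :1 : ∀ {n} → Polynomial n
  :0 = con (0 , 0)
  :1 = con (1 , 0)

  -- Like solve, but the normal forms of the two sides need only be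
  -- equal up to _≟ᶜ_, not syntactically.
  by-ring : ∀ n (f : N-ary n (Polynomial n) (Polynomial n × Polynomial n)) →
            let lhs , rhs = f $ⁿ Vec.map var (allFin n) in
            {_ : T (is-just (normalise lhs ≟N normalise rhs))} →
            ∀ ρ → ⟦ lhs ⟧ ρ ≈ ⟦ rhs ⟧ ρ
  by-ring n f {same} ρ = go (normalise lhs ≟N normalise rhs) same
    where
    lhs = proj₁ (f $ⁿ Vec.map var (allFin n))
    rhs = proj₂ (f $ⁿ Vec.map var (allFin n))
    go : (m : Maybe (normalise lhs ≈N normalise rhs)) → T (is-just m) → ⟦ lhs ⟧ ρ ≈ ⟦ rhs ⟧ ρ
    go (just eq) _ = prove ρ lhs rhs (⟦ eq ⟧N-cong ρ)

module OrderedFieldProperties (R : CompleteOrderedField) where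

  open CompleteOrderedField R public

  commutativeRing : CommutativeRing _ _
  commutativeRing = record
    { Carrier = Carrier ; _≈_ = _≡_ ; _+_ = _+_ ; _*_ = _*_ ; -_ = -_ ; 0# = 0# ; 1# = 1#
    ; isCommutativeRing = record
      { isRing = record
        { +-isAbelianGroup = record
          { isGroup = record
            { isMonoid = record
              { isSemigroup = record
                { isMagma = record { isEquivalence = isEquivalence ; ∙-cong = cong₂ _+_ }
                ; assoc = +-assoc }
              ; identity = +-identityˡ , λ x → trans (+-comm x 0#) (+-identityˡ x) }
            ; inverse = +-inverseˡ , λ x → trans (+-comm x (- x)) (+-inverseˡ x)
            ; ⁻¹-cong = cong (λ x → - x) }
          ; comm = +-comm }
        ; *-cong = cong₂ _*_
        ; *-assoc = *-assoc
        ; *-identity = *-identityˡ , λ x → trans (*-comm x 1#) (*-identityˡ x)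
        ; distrib = distribˡ , λ x y z → trans (*-comm (y + z) x)
                                (trans (distribˡ x y z) (cong₂ _+_ (*-comm x y) (*-comm x z)))
        }
      ; *-comm = *-comm } }

  open CommutativeRing commutativeRing public
    using (+-identityʳ; -‿inverseʳ; *-identityʳ; zeroʳ)
  open IntegerCoefficientSolver commutativeRing public
    using (by-ring; _:+_; _:*_; _:-_; :-_; _:=_; :0; :1)

  <-asym : ∀ {x y} → x < y → ¬ (y < x)
  <-asym {x} x<y y<x = <-irrefl x (<-trans x<y y<x)

  <⇒≢ : ∀ {x y} → x < y → x ≢ y
  <⇒≢ {x} x<x refl = <-irrefl x x<x

  _<?_ : ∀ x y → Dec (x < y)
  x <? y with <-trichotomy x y
  ... | inj₁ x<y = yes x<y
  ... | inj₂ (inj₁ refl) = no (<-irrefl x)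
  ... | inj₂ (inj₂ y<x) = no (<-asym y<x)

  _≟_ : ∀ (x y : Carrier) → Dec (x ≡ y)
  x ≟ y with <-trichotomy x y
  ... | inj₁ x<y = no (<⇒≢ x<y)
  ... | inj₂ (inj₁ x≡y) = yes x≡y
  ... | inj₂ (inj₂ y<x) = no (λ x≡y → <⇒≢ y<x (sym x≡y))

  0<⇒≢0 : ∀ {x} → 0# < x → x ≢ 0#
  0<⇒≢0 0<x x≡0 = <⇒≢ 0<x (sym x≡0)

  ≢0⇒<0⊎0< : ∀ {x} → x ≢ 0# → x < 0# ⊎ 0# < x
  ≢0⇒<0⊎0< {x} x≢0 with <-trichotomy x 0#
  ... | inj₁ x<0 = inj₁ x<0
  ... | inj₂ (inj₁ x≡0) = ⊥-elim (x≢0 x≡0)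
  ... | inj₂ (inj₂ 0<x) = inj₂ 0<x

  x<y⇒0<y-x : ∀ {x y} → x < y → 0# < y - x
  x<y⇒0<y-x {x} {y} x<y = subst (_< y - x) (-‿inverseʳ x) (+-mono-< (- x) x<y)

  0<y-x⇒x<y : ∀ {x y} → 0# < y - x → x < y
  0<y-x⇒x<y {x} {y} 0<y-x = subst₂ _<_ (+-identityˡ x)
    (by-ring 2 (λ x y → (y :- x) :+ x := y) (x ∷ y ∷ [])) (+-mono-< x 0<y-x)

  x<0⇒0<-x : ∀ {x} → x < 0# → 0# < - x
  x<0⇒0<-x {x} x<0 = subst (0# <_) (+-identityˡ (- x)) (x<y⇒0<y-x x<0)

  0<-x⇒x<0 : ∀ {x} → 0# < - x → x < 0#
  0<-x⇒x<0 {x} 0<-x = 0<y-x⇒x<y (subst (0# <_) (sym (+-identityˡ (- x))) 0<-x)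

  neg*neg>0 : ∀ {x y} → x < 0# → y < 0# → 0# < x * y
  neg*neg>0 {x} {y} x<0 y<0 = subst (0# <_) (by-ring 2 (λ x y → (:- x) :* (:- y) := x :* y) (x ∷ y ∷ []))
    (*-pos (x<0⇒0<-x x<0) (x<0⇒0<-x y<0))

  pos*neg<0 : ∀ {x y} → 0# < x → y < 0# → x * y < 0#
  pos*neg<0 {x} {y} 0<x y<0 = 0<-x⇒x<0 (subst (0# <_) (by-ring 2 (λ x y → x :* (:- y) := :- (x :* y)) (x ∷ y ∷ []))
    (*-pos 0<x (x<0⇒0<-x y<0)))

  0<1 : 0# < 1#
  0<1 with <-trichotomy 0# 1#
  ... | inj₁ 0<1 = 0<1
  ... | inj₂ (inj₁ 0≡1) = ⊥-elim (0≢1 0≡1)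
  ... | inj₂ (inj₂ 1<0) = ⊥-elim (<-asym 1<0 (subst (0# <_) (*-identityˡ 1#) (neg*neg>0 1<0 1<0)))

  0<+ : ∀ {x y} → 0# < x → 0# < y → 0# < x + y
  0<+ {x} {y} 0<x 0<y = <-trans 0<y (subst (_< x + y) (+-identityˡ y) (+-mono-< y 0<x))

  y-x≡0⇒x≡y : ∀ {x y} → y - x ≡ 0# → x ≡ y
  y-x≡0⇒x≡y {x} {y} y-x≡0 = sym (begin
    y              ≡⟨ by-ring 2 (λ x y → y := (y :- x) :+ x) (x ∷ y ∷ []) ⟩
    (y - x) + x    ≡⟨ cong (_+ x) y-x≡0 ⟩
    0# + x         ≡⟨ +-identityˡ x ⟩
    x              ∎)
    where open ≡-Reasoning

  0<x*x : ∀ {x} → x ≢ 0# → 0# < x * x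
  0<x*x x≢0 with ≢0⇒<0⊎0< x≢0
  ... | inj₁ x<0 = neg*neg>0 x<0 x<0
  ... | inj₂ 0<x = *-pos 0<x 0<x

  0<x⇒0<x+y*y : ∀ {x} → 0# < x → ∀ y → 0# < x + y * y
  0<x⇒0<x+y*y {x} 0<x y with y ≟ 0#
  ... | yes refl = subst (0# <_) (sym (trans (cong (x +_) (zeroʳ 0#)) (+-identityʳ x))) 0<x
  ... | no y≢0 = 0<+ 0<x (0<x*x y≢0)

  x*y≡0⇒x≡0⊎y≡0 : ∀ {x y} → x * y ≡ 0# → x ≡ 0# ⊎ y ≡ 0#
  x*y≡0⇒x≡0⊎y≡0 {x} {y} xy≡0 with x ≟ 0# | y ≟ 0#
  ... | yes x≡0 | _ = inj₁ x≡0
  ... | no _ | yes y≡0 = inj₂ y≡0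
  ... | no x≢0 | no y≢0 with ≢0⇒<0⊎0< x≢0 | ≢0⇒<0⊎0< y≢0
  ...   | inj₁ x<0 | inj₁ y<0 = ⊥-elim (0<⇒≢0 (neg*neg>0 x<0 y<0) xy≡0)
  ...   | inj₁ x<0 | inj₂ 0<y = ⊥-elim (<⇒≢ (pos*neg<0 0<y x<0) (trans (*-comm y x) xy≡0))
  ...   | inj₂ 0<x | inj₁ y<0 = ⊥-elim (<⇒≢ (pos*neg<0 0<x y<0) xy≡0)
  ...   | inj₂ 0<x | inj₂ 0<y = ⊥-elim (0<⇒≢0 (*-pos 0<x 0<y) xy≡0)

  0<x*y⇒0<y : ∀ {x y} → 0# < x → 0# < x * y → 0# < y
  0<x*y⇒0<y {x} {y} 0<x 0<xy with <-trichotomy y 0#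
  ... | inj₁ y<0 = ⊥-elim (<-asym 0<xy (pos*neg<0 0<x y<0))
  ... | inj₂ (inj₁ refl) = ⊥-elim (0<⇒≢0 0<xy (zeroʳ x))
  ... | inj₂ (inj₂ 0<y) = 0<y

  *-cancelˡ-≡ : ∀ {a x y} → a ≢ 0# → a * x ≡ a * y → x ≡ y
  *-cancelˡ-≡ {a} {x} {y} a≢0 ax≡ay with *-inverse a a≢0
  ... | b , ba≡1 = begin
    x            ≡⟨ *-identityˡ x ⟨
    1# * x       ≡⟨ cong (_* x) ba≡1 ⟨
    (b * a) * x  ≡⟨ *-assoc b a x ⟩
    b * (a * x)  ≡⟨ cong (b *_) ax≡ay ⟩
    b * (a * y)  ≡⟨ *-assoc b a y ⟨
    (b * a) * y  ≡⟨ cong (_* y) ba≡1 ⟩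
    1# * y       ≡⟨ *-identityˡ y ⟩
    y            ∎
    where open ≡-Reasoning

  _⁻¹ : ∀ {x} → 0# < x → Carrier
  0<x ⁻¹ = proj₁ (*-inverse _ (0<⇒≢0 0<x))

  *-inverseʳ : ∀ {x} (0<x : 0# < x) → x * 0<x ⁻¹ ≡ 1#
  *-inverseʳ {x} 0<x = trans (*-comm x _) (proj₂ (*-inverse x (0<⇒≢0 0<x)))

  0<⁻¹ : ∀ {x} (0<x : 0# < x) → 0# < 0<x ⁻¹
  0<⁻¹ 0<x = 0<x*y⇒0<y 0<x (subst (0# <_) (sym (*-inverseʳ 0<x)) 0<1)

  0<t<1⇒0<1-t<1 : ∀ {t} → 0# < t → t < 1# → 0# < 1# - t × 1# - t < 1#
  0<t<1⇒0<1-t<1 {t} 0<t t<1 = x<y⇒0<y-x t<1 , 0<y-x⇒x<y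
    (subst (0# <_) (by-ring 1 (λ t → t := :1 :- (:1 :- t)) (t ∷ [])) 0<t)

  0<x<y⇒0<x/y<1 : ∀ {x y} (0<y : 0# < y) → 0# < x → x < y → 0# < x * 0<y ⁻¹ × x * 0<y ⁻¹ < 1#
  0<x<y⇒0<x/y<1 {x} {y} 0<y 0<x x<y = *-pos 0<x (0<⁻¹ 0<y) , 0<y-x⇒x<y (subst (0# <_) 1-x/y
      (*-pos (0<⁻¹ 0<y) (x<y⇒0<y-x x<y)))
    where
    1-x/y : 0<y ⁻¹ * (y - x) ≡ 1# - x * 0<y ⁻¹
    1-x/y = trans (by-ring 3 (λ y x i → i :* (y :- x) := y :* i :- x :* i) (y ∷ x ∷ 0<y ⁻¹ ∷ []))
                  (cong (_- x * 0<y ⁻¹) (*-inverseʳ 0<y))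

  ≤ᵣ-trans : ∀ {x y z} → x ≤ᵣ y → y ≤ᵣ z → x ≤ᵣ z
  ≤ᵣ-trans (inj₁ x<y) (inj₁ y<z) = inj₁ (<-trans x<y y<z)
  ≤ᵣ-trans (inj₁ x<y) (inj₂ refl) = inj₁ x<y
  ≤ᵣ-trans (inj₂ refl) y≤z = y≤z

  ≤ᵣ-total : ∀ x y → x ≤ᵣ y ⊎ y ≤ᵣ x
  ≤ᵣ-total x y with <-trichotomy x y
  ... | inj₁ x<y = inj₁ (inj₁ x<y)
  ... | inj₂ (inj₁ x≡y) = inj₁ (inj₂ x≡y)
  ... | inj₂ (inj₂ y<x) = inj₂ (inj₁ y<x)

  minimum : ∀ {m} (Q : Fin m → Set) → (∀ k → Dec (Q k)) → (f : Fin m → Carrier) →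
            (∀ k → ¬ Q k) ⊎ ∃ λ e → Q e × ∀ k → Q k → f e ≤ᵣ f k
  minimum {ℕ.zero} Q Q? f = inj₁ λ ()
  minimum {ℕ.suc m} Q Q? f with minimum (Q ∘ suc) (Q? ∘ suc) (f ∘ suc) | Q? zero
  ... | inj₁ none | no ¬q₀ = inj₁ λ { zero q₀ → ¬q₀ q₀ ; (suc k) q → none k q }
  ... | inj₁ none | yes q₀ = inj₂ (zero , q₀ , λ { zero _ → inj₂ refl ; (suc k) q → ⊥-elim (none k q) })
  ... | inj₂ (e , qe , min) | no ¬q₀ = inj₂ (suc e , qe , λ { zero q₀ → ⊥-elim (¬q₀ q₀) ; (suc k) q → min k q })
  ... | inj₂ (e , qe , min) | yes q₀ with ≤ᵣ-total (f zero) (f (suc e))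
  ...   | inj₁ f₀≤fe = inj₂ (zero , q₀ , λ { zero _ → inj₂ refl ; (suc k) q → ≤ᵣ-trans f₀≤fe (min k q) })
  ...   | inj₂ fe≤f₀ = inj₂ (suc e , qe , λ { zero _ → fe≤f₀ ; (suc k) q → min k q })

module PlaneGeometry (R : CompleteOrderedField) where

  open OrderedFieldProperties R public
  open ≡-Reasoning

  Pt : Set
  Pt = Point R

  lerp₁ : Carrier → Carrier → Carrier → Carrier
  lerp₁ x y t = x + t * (y - x)

  lerp : Pt → Pt → Carrier → Pt
  lerp (ax , ay) (bx , by) t = lerp₁ ax bx t , lerp₁ ay by t

  infix 4 _∈⦅_,_⦆
  _∈⦅_,_⦆ : Pt → Pt → Pt → Set
  c ∈⦅ a , b ⦆ = InOpenSegment R a b c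

  ∈⦅⦆⇒≡lerp : ∀ {a b c} → c ∈⦅ a , b ⦆ → ∃ λ t → 0# < t × t < 1# × c ≡ lerp a b t
  ∈⦅⦆⇒≡lerp (t , 0<t , t<1 , x≡ , y≡) = t , 0<t , t<1 , cong₂ _,_ x≡ y≡

  lerp-∈⦅⦆ : ∀ a b {t} → 0# < t → t < 1# → lerp a b t ∈⦅ a , b ⦆
  lerp-∈⦅⦆ a b {t} 0<t t<1 = t , 0<t , t<1 , refl , refl

  ≡lerp⇒∈⦅⦆ : ∀ {a b c t} → 0# < t → t < 1# → c ≡ lerp a b t → c ∈⦅ a , b ⦆
  ≡lerp⇒∈⦅⦆ {a} {b} 0<t t<1 refl = lerp-∈⦅⦆ a b 0<t t<1

  lerp₁-sym : ∀ x y t → lerp₁ x y t ≡ lerp₁ y x (1# - t)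
  lerp₁-sym x y t = by-ring 3 (λ x y t → x :+ t :* (y :- x) := y :+ (:1 :- t) :* (x :- y)) (x ∷ y ∷ t ∷ [])

  lerp₁-const : ∀ x t → lerp₁ x x t ≡ x
  lerp₁-const x t = by-ring 2 (λ x t → x :+ t :* (x :- x) := x) (x ∷ t ∷ [])

  lerp₁-lerp₁ : ∀ x y s u r → lerp₁ (lerp₁ x y s) (lerp₁ x y u) r ≡ lerp₁ x y (lerp₁ s u r)
  lerp₁-lerp₁ x y s u r = by-ring 5 (λ x y s u r →
    (x :+ s :* (y :- x)) :+ r :* ((x :+ u :* (y :- x)) :- (x :+ s :* (y :- x)))
      := x :+ (s :+ r :* (u :- s)) :* (y :- x)) (x ∷ y ∷ s ∷ u ∷ r ∷ [])

  lerp₁-from-0 : ∀ y t → lerp₁ 0# y t ≡ t * y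
  lerp₁-from-0 y t = by-ring 2 (λ y t → :0 :+ t :* (y :- :0) := t :* y) (y ∷ t ∷ [])

  lerp₁-injectiveˡ : ∀ {x z} w {t} → t < 1# → lerp₁ x w t ≡ lerp₁ z w t → x ≡ z
  lerp₁-injectiveˡ {x} {z} w {t} t<1 eq = *-cancelˡ-≡ (0<⇒≢0 (x<y⇒0<y-x t<1)) (begin
    (1# - t) * x        ≡⟨ by-ring 3 (λ x w t → (:1 :- t) :* x := (x :+ t :* (w :- x)) :- t :* w)
                                     (x ∷ w ∷ t ∷ []) ⟩
    lerp₁ x w t - t * w ≡⟨ cong (_- t * w) eq ⟩
    lerp₁ z w t - t * w ≡⟨ by-ring 3 (λ z w t → (z :+ t :* (w :- z)) :- t :* w := (:1 :- t) :* z)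
                                     (z ∷ w ∷ t ∷ []) ⟩
    (1# - t) * z        ∎)

  lerp₁≡start⇒≡ : ∀ {x y t} → t ≢ 0# → lerp₁ x y t ≡ x → x ≡ y
  lerp₁≡start⇒≡ {x} {y} {t} t≢0 eq = [ (λ t≡0 → ⊥-elim (t≢0 t≡0)) , y-x≡0⇒x≡y ]′
    (x*y≡0⇒x≡0⊎y≡0 (begin
      t * (y - x)          ≡⟨ by-ring 3 (λ x y t → t :* (y :- x) := (x :+ t :* (y :- x)) :- x)
                                      (x ∷ y ∷ t ∷ []) ⟩
      lerp₁ x y t - x      ≡⟨ cong (_- x) eq ⟩
      x - x                ≡⟨ -‿inverseʳ x ⟩
      0#                   ∎))

  lerp-lerp-start : ∀ a b t s → lerp a (lerp a b t) s ≡ lerp a b (s * t)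
  lerp-lerp-start (ax , ay) (bx , by) t s = cong₂ _,_ (lemma ax bx) (lemma ay by)
    where
    lemma : ∀ x y → lerp₁ x (lerp₁ x y t) s ≡ lerp₁ x y (s * t)
    lemma x y = by-ring 4 (λ x y t s → x :+ s :* ((x :+ t :* (y :- x)) :- x) := x :+ (s :* t) :* (y :- x))
                          (x ∷ y ∷ t ∷ s ∷ [])

  ∈⦅⦆-sym : ∀ {a b c} → c ∈⦅ a , b ⦆ → c ∈⦅ b , a ⦆
  ∈⦅⦆-sym {ax , ay} {bx , by} (t , 0<t , t<1 , x≡ , y≡) =
    let 0<1-t , 1-t<1 = 0<t<1⇒0<1-t<1 0<t t<1
    in 1# - t , 0<1-t , 1-t<1 , trans x≡ (lerp₁-sym ax bx t) , trans y≡ (lerp₁-sym ay by t)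

  ∈⦅a,a⦆⇒≡a : ∀ {a c} → c ∈⦅ a , a ⦆ → c ≡ a
  ∈⦅a,a⦆⇒≡a {ax , ay} (t , _ , _ , x≡ , y≡) =
    cong₂ _,_ (trans x≡ (lerp₁-const ax t)) (trans y≡ (lerp₁-const ay t))

  ∈⦅⦆⇒≢ˡ : ∀ {a b c} → c ∈⦅ a , b ⦆ → a ≢ b → c ≢ a
  ∈⦅⦆⇒≢ˡ (t , 0<t , _ , x≡ , y≡) a≢b refl =
    a≢b (cong₂ _,_ (lerp₁≡start⇒≡ (0<⇒≢0 0<t) (sym x≡)) (lerp₁≡start⇒≡ (0<⇒≢0 0<t) (sym y≡)))

  ∈⦅⦆⇒≢ʳ : ∀ {a b c} → c ∈⦅ a , b ⦆ → a ≢ b → c ≢ b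
  ∈⦅⦆⇒≢ʳ c∈ab a≢b = ∈⦅⦆⇒≢ˡ (∈⦅⦆-sym c∈ab) (λ b≡a → a≢b (sym b≡a))

  lerp-lerp : ∀ a b s u r → lerp (lerp a b s) (lerp a b u) r ≡ lerp a b (lerp₁ s u r)
  lerp-lerp (ax , ay) (bx , by) s u r = cong₂ _,_ (lerp₁-lerp₁ ax bx s u r) (lerp₁-lerp₁ ay by s u r)

  ∈⦅⦆-lerp : ∀ a b {s t u} → s < t → t < u → lerp a b t ∈⦅ lerp a b s , lerp a b u ⦆
  ∈⦅⦆-lerp a b {s} {t} {u} s<t t<u = ≡lerp⇒∈⦅⦆ 0<r r<1 (begin
    lerp a b t                          ≡⟨ cong (lerp a b) lerp₁-s-u-r≡t ⟨
    lerp a b (lerp₁ s u r)              ≡⟨ lerp-lerp a b s u r ⟨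
    lerp (lerp a b s) (lerp a b u) r    ∎)
    where
    0<u-s = x<y⇒0<y-x (<-trans s<t t<u)
    r = (t - s) * 0<u-s ⁻¹
    0<r,r<1 = 0<x<y⇒0<x/y<1 0<u-s (x<y⇒0<y-x s<t) (+-mono-< (- s) t<u)
    0<r = proj₁ 0<r,r<1
    r<1 = proj₂ 0<r,r<1
    lerp₁-s-u-r≡t : lerp₁ s u r ≡ t
    lerp₁-s-u-r≡t = begin
      s + r * (u - s)                          ≡⟨ by-ring 4 (λ s t u i → s :+ ((t :- s) :* i) :* (u :- s)
                                                    := s :+ (t :- s) :* ((u :- s) :* i)) (s ∷ t ∷ u ∷ 0<u-s ⁻¹ ∷ []) ⟩
      s + (t - s) * ((u - s) * 0<u-s ⁻¹)       ≡⟨ cong (λ z → s + (t - s) * z) (*-inverseʳ 0<u-s) ⟩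
      s + (t - s) * 1#                         ≡⟨ by-ring 2 (λ s t → s :+ (t :- s) :* :1 := t) (s ∷ t ∷ []) ⟩
      t                                        ∎

  ∈⦅⦆-shrinkʳ : ∀ {a b c r} → c ∈⦅ a , b ⦆ → r ∈⦅ a , c ⦆ → r ∈⦅ a , b ⦆
  ∈⦅⦆-shrinkʳ {a} {b} c∈ab r∈ac with ∈⦅⦆⇒≡lerp c∈ab
  ... | t , 0<t , t<1 , refl with ∈⦅⦆⇒≡lerp r∈ac
  ... | s , 0<s , s<1 , refl = ≡lerp⇒∈⦅⦆ (*-pos 0<s 0<t) (<-trans st<t t<1) (lerp-lerp-start a b t s)
    where
    st<t : s * t < t
    st<t = 0<y-x⇒x<y (subst (0# <_) (by-ring 2 (λ s t → t :* (:1 :- s) := t :- s :* t) (s ∷ t ∷ []))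
                                     (*-pos 0<t (x<y⇒0<y-x s<1)))

  ∈⦅⦆-shrinkˡ : ∀ {a b c r} → c ∈⦅ a , b ⦆ → r ∈⦅ c , b ⦆ → r ∈⦅ a , b ⦆
  ∈⦅⦆-shrinkˡ c∈ab r∈cb = ∈⦅⦆-sym (∈⦅⦆-shrinkʳ (∈⦅⦆-sym c∈ab) (∈⦅⦆-sym r∈cb))

  -- twice the signed area of the triangle abc
  orient : Pt → Pt → Pt → Carrier
  orient (ax , ay) (bx , by) (cx , cy) = (bx - ax) * (cy - ay) - (by - ay) * (cx - ax)

  Collinear : Pt → Pt → Pt → Set
  Collinear a b c = orient a b c ≡ 0#

  orient-lerp : ∀ u v a b t → orient u v (lerp a b t) ≡ lerp₁ (orient u v a) (orient u v b) t
  orient-lerp (ux , uy) (vx , vy) (ax , ay) (bx , by) t = by-ring 9 (λ ux uy vx vy ax ay bx by t →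
    (vx :- ux) :* ((ay :+ t :* (by :- ay)) :- uy) :- (vy :- uy) :* ((ax :+ t :* (bx :- ax)) :- ux)
      := ((vx :- ux) :* (ay :- uy) :- (vy :- uy) :* (ax :- ux))
         :+ t :* (((vx :- ux) :* (by :- uy) :- (vy :- uy) :* (bx :- ux))
                  :- ((vx :- ux) :* (ay :- uy) :- (vy :- uy) :* (ax :- ux))))
    (ux ∷ uy ∷ vx ∷ vy ∷ ax ∷ ay ∷ bx ∷ by ∷ t ∷ [])

  orient-∈⦅⦆ : ∀ {a b c} → c ∈⦅ a , b ⦆ → ∀ u v →
               ∃ λ t → 0# < t × t < 1# × orient u v c ≡ lerp₁ (orient u v a) (orient u v b) t
  orient-∈⦅⦆ {a} {b} c∈ab u v with ∈⦅⦆⇒≡lerp c∈ab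
  ... | t , 0<t , t<1 , refl = t , 0<t , t<1 , orient-lerp u v a b t

  collinear-start : ∀ a b → Collinear a b a
  collinear-start (ax , ay) (bx , by) = by-ring 4 (λ ax ay bx by →
    (bx :- ax) :* (ay :- ay) :- (by :- ay) :* (ax :- ax) := :0) (ax ∷ ay ∷ bx ∷ by ∷ [])

  collinear-end : ∀ a b → Collinear a b b
  collinear-end (ax , ay) (bx , by) = by-ring 4 (λ ax ay bx by →
    (bx :- ax) :* (by :- ay) :- (by :- ay) :* (bx :- ax) := :0) (ax ∷ ay ∷ bx ∷ by ∷ [])

  orient-swap : ∀ a b c → orient b a c ≡ - orient a b c
  orient-swap (ax , ay) (bx , by) (cx , cy) = by-ring 6 (λ ax ay bx by cx cy →
    (ax :- bx) :* (cy :- by) :- (ay :- by) :* (cx :- bx)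
      := :- ((bx :- ax) :* (cy :- ay) :- (by :- ay) :* (cx :- ax))) (ax ∷ ay ∷ bx ∷ by ∷ cx ∷ cy ∷ [])

  collinear-swap : ∀ {a b c} → Collinear a b c → Collinear b a c
  collinear-swap {a} {b} {c} abc = trans (orient-swap a b c)
    (trans (cong -_ abc) (by-ring 0 (:- :0 := :0) []))

  orient-rotate : ∀ a b c → orient a b c ≡ orient c a b
  orient-rotate (ax , ay) (bx , by) (cx , cy) = by-ring 6 (λ ax ay bx by cx cy →
    (bx :- ax) :* (cy :- ay) :- (by :- ay) :* (cx :- ax)
      := (ax :- cx) :* (by :- cy) :- (ay :- cy) :* (bx :- cx)) (ax ∷ ay ∷ bx ∷ by ∷ cx ∷ cy ∷ [])

  orient-lerp-from-line : ∀ {u v a} b t → Collinear u v a → orient u v (lerp a b t) ≡ t * orient u v b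
  orient-lerp-from-line {u} {v} {a} b t a-on = begin
    orient u v (lerp a b t)                      ≡⟨ orient-lerp u v a b t ⟩
    lerp₁ (orient u v a) (orient u v b) t        ≡⟨ cong (λ o → lerp₁ o (orient u v b) t) a-on ⟩
    lerp₁ 0# (orient u v b) t                    ≡⟨ lerp₁-from-0 (orient u v b) t ⟩
    t * orient u v b                             ∎

  orient-∈⦅⦆-from-line : ∀ {a b c} → c ∈⦅ a , b ⦆ → ∀ {u v} → Collinear u v a →
                         ∃ λ t → 0# < t × t < 1# × orient u v c ≡ t * orient u v b
  orient-∈⦅⦆-from-line {b = b} c∈ab a-on with ∈⦅⦆⇒≡lerp c∈ab
  ... | t , 0<t , t<1 , refl = t , 0<t , t<1 , orient-lerp-from-line b t a-on

  ∈⦅⦆⇒collinear : ∀ {a b c} → c ∈⦅ a , b ⦆ → Collinear a b c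
  ∈⦅⦆⇒collinear {a} {b} c∈ab =
    let t , _ , _ , eq = orient-∈⦅⦆-from-line c∈ab (collinear-start a b)
    in trans eq (trans (cong (t *_) (collinear-end a b)) (zeroʳ t))

  collinear-∈⦅⦆ʳ : ∀ {a b c u v} → c ∈⦅ a , b ⦆ → Collinear u v c → Collinear u v a → Collinear u v b
  collinear-∈⦅⦆ʳ c∈ab c-on a-on =
    let t , 0<t , _ , eq = orient-∈⦅⦆-from-line c∈ab a-on
    in [ (λ t≡0 → ⊥-elim (0<⇒≢0 0<t t≡0)) , (λ b-on → b-on) ]′ (x*y≡0⇒x≡0⊎y≡0 (trans (sym eq) c-on))

  collinear-∈⦅⦆ˡ : ∀ {a b c u v} → c ∈⦅ a , b ⦆ → Collinear u v c → Collinear u v b → Collinear u v a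
  collinear-∈⦅⦆ˡ c∈ab = collinear-∈⦅⦆ʳ (∈⦅⦆-sym c∈ab)

  central-projection-injective : ∀ {u v a c w y} → Collinear u v a → Collinear u v c → ¬ Collinear u v w →
                                 y ∈⦅ a , w ⦆ → y ∈⦅ c , w ⦆ → a ≡ c
  central-projection-injective {u} {v} {a} {c} {w} a-on c-on w-off y∈aw y∈cw
    with ∈⦅⦆⇒≡lerp y∈aw | ∈⦅⦆⇒≡lerp y∈cw
  ... | r , _ , r<1 , refl | s , _ , _ , y≡ =
    cong₂ _,_ (lerp₁-injectiveˡ _ r<1 (cong proj₁ same)) (lerp₁-injectiveˡ _ r<1 (cong proj₂ same))
    where
    r≡s : r ≡ s
    r≡s = *-cancelˡ-≡ w-off (begin
      orient u v w * r          ≡⟨ *-comm _ r ⟩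
      r * orient u v w          ≡⟨ orient-lerp-from-line w r a-on ⟨
      orient u v (lerp a w r)   ≡⟨ cong (orient u v) y≡ ⟩
      orient u v (lerp c w s)   ≡⟨ orient-lerp-from-line w s c-on ⟩
      s * orient u v w          ≡⟨ *-comm s _ ⟩
      orient u v w * s          ∎)
    same : lerp a w r ≡ lerp c w r
    same = trans y≡ (cong (lerp c w) (sym r≡s))

  ≢⇒Δ≢0 : ∀ {a b : Pt} → a ≢ b → proj₁ b - proj₁ a ≢ 0# ⊎ proj₂ b - proj₂ a ≢ 0#
  ≢⇒Δ≢0 {ax , ay} {bx , by} a≢b with (bx - ax) ≟ 0# | (by - ay) ≟ 0#
  ... | yes Δx≡0 | yes Δy≡0 = ⊥-elim (a≢b (cong₂ _,_ (y-x≡0⇒x≡y Δx≡0) (y-x≡0⇒x≡y Δy≡0)))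
  ... | no Δx≢0 | _ = inj₁ Δx≢0
  ... | yes _ | no Δy≢0 = inj₂ Δy≢0

  -- Coordinatewise, (w - y) · orient y u v = (u - y) · orient y w v - (v - y) · orient y w u.
  collinear-pivot : ∀ {y w u v} → y ≢ w → Collinear y w u → Collinear y w v → Collinear y u v
  collinear-pivot {yx , yy} {wx , wy} {ux , uy} {vx , vy} y≢w u-on v-on with ≢⇒Δ≢0 y≢w
  ... | inj₁ Δx≢0 = *-cancelˡ-≡ Δx≢0 (begin
    (wx - yx) * orient (yx , yy) (ux , uy) (vx , vy)
      ≡⟨ by-ring 8 (λ yx yy wx wy ux uy vx vy → (wx :- yx) :* ((ux :- yx) :* (vy :- yy) :- (uy :- yy) :* (vx :- yx))
           := (ux :- yx) :* ((wx :- yx) :* (vy :- yy) :- (wy :- yy) :* (vx :- yx))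
              :- (vx :- yx) :* ((wx :- yx) :* (uy :- yy) :- (wy :- yy) :* (ux :- yx)))
           (yx ∷ yy ∷ wx ∷ wy ∷ ux ∷ uy ∷ vx ∷ vy ∷ []) ⟩
    (ux - yx) * orient _ _ (vx , vy) - (vx - yx) * orient _ _ (ux , uy)
      ≡⟨ cong₂ (λ o o′ → (ux - yx) * o - (vx - yx) * o′) v-on u-on ⟩
    (ux - yx) * 0# - (vx - yx) * 0#
      ≡⟨ by-ring 3 (λ a b c → a :* :0 :- b :* :0 := c :* :0) (ux - yx ∷ vx - yx ∷ wx - yx ∷ []) ⟩
    (wx - yx) * 0#  ∎)
  ... | inj₂ Δy≢0 = *-cancelˡ-≡ Δy≢0 (begin
    (wy - yy) * orient (yx , yy) (ux , uy) (vx , vy)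
      ≡⟨ by-ring 8 (λ yx yy wx wy ux uy vx vy → (wy :- yy) :* ((ux :- yx) :* (vy :- yy) :- (uy :- yy) :* (vx :- yx))
           := (uy :- yy) :* ((wx :- yx) :* (vy :- yy) :- (wy :- yy) :* (vx :- yx))
              :- (vy :- yy) :* ((wx :- yx) :* (uy :- yy) :- (wy :- yy) :* (ux :- yx)))
           (yx ∷ yy ∷ wx ∷ wy ∷ ux ∷ uy ∷ vx ∷ vy ∷ []) ⟩
    (uy - yy) * orient _ _ (vx , vy) - (vy - yy) * orient _ _ (ux , uy)
      ≡⟨ cong₂ (λ o o′ → (uy - yy) * o - (vy - yy) * o′) v-on u-on ⟩
    (uy - yy) * 0# - (vy - yy) * 0#
      ≡⟨ by-ring 3 (λ a b c → a :* :0 :- b :* :0 := c :* :0) (uy - yy ∷ vy - yy ∷ wy - yy ∷ []) ⟩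
    (wy - yy) * 0#  ∎)

  concurrent⇒collinear : ∀ {u v w b y} → y ∈⦅ u , w ⦆ → y ∈⦅ b , w ⦆ → y ∈⦅ b , v ⦆ → y ≢ w →
                          Collinear u v y
  concurrent⇒collinear {u} {v} {w} {b} {y} y∈uw y∈bw y∈bv y≢w =
    trans (orient-rotate u v y) (collinear-pivot y≢w u-on v-on)
    where
    u-on = collinear-∈⦅⦆ˡ y∈uw (collinear-start y w) (collinear-end y w)
    b-on = collinear-∈⦅⦆ˡ y∈bw (collinear-start y w) (collinear-end y w)
    v-on = collinear-∈⦅⦆ʳ y∈bv (collinear-start y w) b-on

  SameSide : Pt → Pt → Pt → Pt → Set
  SameSide u v b w = 0# < orient u v b * orient u v w

  crossing⇒sameSide : ∀ {u v w b y} → y ∈⦅ u , w ⦆ → y ∈⦅ v , b ⦆ → ¬ Collinear u v w → SameSide u v b w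
  crossing⇒sameSide {u} {v} {w} {b} y∈uw y∈vb w-off
    with ∈⦅⦆⇒≡lerp y∈uw | ∈⦅⦆⇒≡lerp y∈vb
  ... | r , 0<r , _ , refl | q , 0<q , _ , y≡ = 0<x*y⇒0<y 0<q (subst (0# <_) rW²≡qBW (*-pos 0<r (0<x*x w-off)))
    where
    B = orient u v b
    W = orient u v w
    rW≡qB : r * W ≡ q * B
    rW≡qB = begin
      r * W                    ≡⟨ orient-lerp-from-line w r (collinear-start u v) ⟨
      orient u v (lerp u w r)  ≡⟨ cong (orient u v) y≡ ⟩
      orient u v (lerp v b q)  ≡⟨ orient-lerp-from-line b q (collinear-end u v) ⟩
      q * B                    ∎
    rW²≡qBW : r * (W * W) ≡ q * (B * W)
    rW²≡qBW = trans (sym (*-assoc r W W)) (trans (cong (_* W) rW≡qB) (*-assoc q B W))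

  sameSide⇒∈⦅⦆-off-line : ∀ {u v b w x} → SameSide u v b w → x ∈⦅ b , w ⦆ → ¬ Collinear u v x
  sameSide⇒∈⦅⦆-off-line {u} {v} {b} {w} {x} 0<BW x∈bw x-on with orient-∈⦅⦆ x∈bw u v
  ... | t , 0<t , t<1 , X≡ = 0<⇒≢0 0<W*X (begin
    W * X              ≡⟨ cong (W *_) x-on ⟩
    W * 0#             ≡⟨ zeroʳ W ⟩
    0#                 ∎)
    where
    B = orient u v b
    W = orient u v w
    X = orient u v x
    W≢0 : W ≢ 0#
    W≢0 W≡0 = 0<⇒≢0 0<BW (trans (cong (B *_) W≡0) (zeroʳ B))
    0<W*X : 0# < W * X
    0<W*X = subst (0# <_)
      (trans (by-ring 3 (λ B W t → (:1 :- t) :* (B :* W) :+ t :* (W :* W) := W :* (B :+ t :* (W :- B)))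
                        (B ∷ W ∷ t ∷ [])) (cong (W *_) (sym X≡)))
      (0<+ (*-pos (proj₁ (0<t<1⇒0<1-t<1 0<t t<1)) 0<BW) (*-pos 0<t (0<x*x W≢0)))

  inner : Pt → Pt → Pt → Carrier
  inner (ax , ay) (bx , by) (cx , cy) = (bx - ax) * (cx - ax) + (by - ay) * (cy - ay)

  0<inner-end : ∀ {a b} → a ≢ b → 0# < inner a b b
  0<inner-end {ax , ay} {bx , by} a≢b with ≢⇒Δ≢0 a≢b
  ... | inj₁ Δx≢0 = 0<x⇒0<x+y*y (0<x*x Δx≢0) (by - ay)
  ... | inj₂ Δy≢0 = subst (0# <_) (+-comm _ _) (0<x⇒0<x+y*y (0<x*x Δy≢0) (bx - ax))

  -- The coordinate of the orthogonal projection of c onto the line ab,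
  -- with a at 0 and b at 1.
  param : ∀ {a b} → a ≢ b → Pt → Carrier
  param {a} {b} a≢b c = inner a b c * 0<inner-end a≢b ⁻¹

  param-lerp : ∀ {a b} (a≢b : a ≢ b) t → param a≢b (lerp a b t) ≡ t
  param-lerp {ax , ay} {bx , by} a≢b t = begin
    inner a b (lerp a b t) * N⁻¹
      ≡⟨ cong (_* N⁻¹) (by-ring 5 (λ ax ay bx by t →
           (bx :- ax) :* ((ax :+ t :* (bx :- ax)) :- ax) :+ (by :- ay) :* ((ay :+ t :* (by :- ay)) :- ay)
             := t :* ((bx :- ax) :* (bx :- ax) :+ (by :- ay) :* (by :- ay)))
           (ax ∷ ay ∷ bx ∷ by ∷ t ∷ [])) ⟩
    (t * inner a b b) * N⁻¹        ≡⟨ *-assoc t _ N⁻¹ ⟩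
    t * (inner a b b * N⁻¹)        ≡⟨ cong (t *_) (*-inverseʳ (0<inner-end a≢b)) ⟩
    t * 1#                         ≡⟨ *-identityʳ t ⟩
    t                              ∎
    where
    a = (ax , ay)
    b = (bx , by)
    N⁻¹ = 0<inner-end a≢b ⁻¹

  -- Coordinatewise, |b - a|² (c - a) = ((b - a) · (c - a)) (b - a) - orient a b c (b - a)^⊥.
  collinear⇒≡lerp : ∀ {a b c} (a≢b : a ≢ b) → Collinear a b c → c ≡ lerp a b (param a≢b c)
  collinear⇒≡lerp {ax , ay} {bx , by} {cx , cy} a≢b c-on = cong₂ _,_
    (solve-coordinate (by-ring 6 (λ ax ay bx by cx cy →
        ((bx :- ax) :* (bx :- ax) :+ (by :- ay) :* (by :- ay)) :* (cx :- ax)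
          := ((bx :- ax) :* (cx :- ax) :+ (by :- ay) :* (cy :- ay)) :* (bx :- ax)
             :- (by :- ay) :* ((bx :- ax) :* (cy :- ay) :- (by :- ay) :* (cx :- ax)))
        (ax ∷ ay ∷ bx ∷ by ∷ cx ∷ cy ∷ [])))
    (solve-coordinate (by-ring 6 (λ ax ay bx by cx cy →
        ((bx :- ax) :* (bx :- ax) :+ (by :- ay) :* (by :- ay)) :* (cy :- ay)
          := ((bx :- ax) :* (cx :- ax) :+ (by :- ay) :* (cy :- ay)) :* (by :- ay)
             :- (:- (bx :- ax)) :* ((bx :- ax) :* (cy :- ay) :- (by :- ay) :* (cx :- ax)))
        (ax ∷ ay ∷ bx ∷ by ∷ cx ∷ cy ∷ [])))
    where
    a = (ax , ay)
    b = (bx , by)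
    c = (cx , cy)
    0<N = 0<inner-end a≢b
    N = inner a b b
    D = inner a b c
    N⁻¹ = 0<N ⁻¹
    solve-coordinate : ∀ {p q r e} → N * (r - p) ≡ D * (q - p) - e * orient a b c →
                       r ≡ lerp₁ p q (param a≢b c)
    solve-coordinate {p} {q} {r} {e} eq = begin
      r                      ≡⟨ by-ring 2 (λ p r → r := p :+ (r :- p)) (p ∷ r ∷ []) ⟩
      p + (r - p)            ≡⟨ cong (p +_) (*-cancelˡ-≡ (0<⇒≢0 0<N) (trans N[r-p]≡D[q-p] (sym N·λ[q-p]≡D[q-p]))) ⟩
      p + (D * N⁻¹) * (q - p) ∎
      where
      N[r-p]≡D[q-p] : N * (r - p) ≡ D * (q - p)
      N[r-p]≡D[q-p] = trans eq (trans (cong (λ o → D * (q - p) - e * o) c-on)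
                                      (by-ring 2 (λ x e → x :- e :* :0 := x) (D * (q - p) ∷ e ∷ [])))
      N·λ[q-p]≡D[q-p] : N * ((D * N⁻¹) * (q - p)) ≡ D * (q - p)
      N·λ[q-p]≡D[q-p] = begin
        N * ((D * N⁻¹) * (q - p))   ≡⟨ by-ring 4 (λ n d i z → n :* ((d :* i) :* z) := (n :* i) :* (d :* z))
                                                 (N ∷ D ∷ N⁻¹ ∷ q - p ∷ []) ⟩
        (N * N⁻¹) * (D * (q - p))  ≡⟨ cong (_* (D * (q - p))) (*-inverseʳ 0<N) ⟩
        1# * (D * (q - p))         ≡⟨ *-identityˡ _ ⟩
        D * (q - p)                ∎

  ∈⦅⦆⇒0<param<1 : ∀ {a b c} (a≢b : a ≢ b) → c ∈⦅ a , b ⦆ → 0# < param a≢b c × param a≢b c < 1#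
  ∈⦅⦆⇒0<param<1 a≢b c∈ab with ∈⦅⦆⇒≡lerp c∈ab
  ... | t , 0<t , t<1 , refl = subst (λ s → 0# < s × s < 1#) (sym (param-lerp a≢b t)) (0<t , t<1)

  ∈⦅⦆? : ∀ {a b} → a ≢ b → ∀ c → Dec (c ∈⦅ a , b ⦆)
  ∈⦅⦆? {a} {b} a≢b c with orient a b c ≟ 0#
  ... | no c-off = no (λ c∈ab → c-off (∈⦅⦆⇒collinear c∈ab))
  ... | yes c-on with 0# <? param a≢b c | param a≢b c <? 1#
  ...   | yes 0<t | yes t<1 = yes (≡lerp⇒∈⦅⦆ 0<t t<1 (collinear⇒≡lerp a≢b c-on))
  ...   | no ¬0<t | _ = no (λ c∈ab → ¬0<t (proj₁ (∈⦅⦆⇒0<param<1 a≢b c∈ab)))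
  ...   | _ | no ¬t<1 = no (λ c∈ab → ¬t<1 (proj₂ (∈⦅⦆⇒0<param<1 a≢b c∈ab)))

  param-injective : ∀ {a b c d} (a≢b : a ≢ b) → Collinear a b c → Collinear a b d →
                    param a≢b c ≡ param a≢b d → c ≡ d
  param-injective {a} {b} a≢b c-on d-on eq =
    trans (collinear⇒≡lerp a≢b c-on) (trans (cong (lerp a b) eq) (sym (collinear⇒≡lerp a≢b d-on)))

  collinear-ordered⇒∈⦅⦆ : ∀ {a b c d e} (a≢b : a ≢ b) → Collinear a b c → Collinear a b d → Collinear a b e →
                          param a≢b c < param a≢b d → param a≢b d < param a≢b e → d ∈⦅ c , e ⦆
  collinear-ordered⇒∈⦅⦆ {a} {b} {c} {d} {e} a≢b c-on d-on e-on c<d d<e =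
    subst (λ z → z ∈⦅ c , e ⦆) (sym (collinear⇒≡lerp a≢b d-on))
      (subst₂ (λ z z′ → lerp a b (param a≢b d) ∈⦅ z , z′ ⦆)
        (sym (collinear⇒≡lerp a≢b c-on)) (sym (collinear⇒≡lerp a≢b e-on))
        (∈⦅⦆-lerp a b c<d d<e))

fresh : ∀ {n} (L : List (Fin n)) → length L ℕ.< n → ∃ λ z → z ∉ L
fresh {n} L |L|<n with Fin.any? (λ z → ¬? (Any.any? (z Fin.≟_) L))
... | yes z∉L = z∉L
... | no ¬z∉L = ⊥-elim (ℕ.<⇒≱ |L|<n (Fin.injective⇒≤ {f = position} position-injective))
  where
  ∈L : ∀ z → z ∈ L
  ∈L z with Any.any? (z Fin.≟_) L
  ... | yes z∈L = z∈L
  ... | no z∉L = ⊥-elim (¬z∉L (z , z∉L))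
  position : Fin n → Fin (length L)
  position z = index (∈L z)
  position-injective : Injective _≡_ _≡_ position
  position-injective {z} {z′} eq =
    trans (lookup-index (∈L z)) (trans (cong (lookup L) eq) (sym (lookup-index (∈L z′))))

four-distinct⇒4≤n : ∀ {n} {a b c d : Fin n} → a ≢ b → a ≢ c → a ≢ d → b ≢ c → b ≢ d → c ≢ d → 4 ℕ.≤ n
four-distinct⇒4≤n a≢b a≢c a≢d b≢c b≢d c≢d = Fin.injective⇒≤ (lookup-injective distinct _ _)
  where
  distinct = (a≢b All.∷ a≢c All.∷ a≢d All.∷ All.[]) AllPairs.∷ (b≢c All.∷ b≢d All.∷ All.[])
             AllPairs.∷ (c≢d All.∷ All.[]) AllPairs.∷ All.[] AllPairs.∷ AllPairs.[]

module GraphProperties {n : ℕ} (Adj : Fin n → Fin n → Set) (irreflexive : ∀ {u v} → Adj u v → u ≢ v) where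

  infixr 5 _++ʷ_

  _++ʷ_ : ∀ {V E u v w} → Walk Adj V E u v → Walk Adj V E v w → Walk Adj V E u w
  here ++ʷ q = q
  step uv e ok p ++ʷ q = step uv e ok (p ++ʷ q)

  mapᵛ : ∀ {V V′ : Fin n → Set} {E u v} → (∀ k → V k → V′ k) → Walk Adj V E u v → Walk Adj V′ E u v
  mapᵛ f here = here
  mapᵛ f (step uv e ok p) = step uv e (f _ ok) (mapᵛ f p)

  first-edge : ∀ {V E u v} → Walk Adj V E u v → u ≢ v → ∃ λ a → Adj u a × V a × E u a
  first-edge here u≢u = ⊥-elim (u≢u refl)
  first-edge (step ua e ok _) _ = _ , ua , ok , e

  neighbour-outside : VertexConn≥3 Adj → ∀ v S → length S ℕ.≤ 2 → v ∉ S → ∃ λ a → Adj v a × a ∉ S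
  neighbour-outside (4≤n , conn) v S |S|≤2 v∉S =
    let t , t∉ = fresh (v ∷ S) (ℕ.≤-trans (s≤s (s≤s |S|≤2)) 4≤n)
        a , va , a∉S , _ = first-edge (conn S |S|≤2 v t v∉S (t∉ ∘ there)) (λ v≡t → t∉ (here (sym v≡t)))
    in a , va , a∉S

  vertexConn⇒minDegree : VertexConn≥3 Adj → MinDegree≥3 Adj
  vertexConn⇒minDegree κ v =
    let a , va , _ = neighbour-outside κ v [] z≤n (λ ())
        b , vb , b∉a = neighbour-outside κ v (a ∷ []) (s≤s z≤n) (λ { (here v≡a) → irreflexive va v≡a })
        c , vc , c∉ab = neighbour-outside κ v (a ∷ b ∷ []) (s≤s (s≤s z≤n))
                          (λ { (here v≡a) → irreflexive va v≡a ; (there (here v≡b)) → irreflexive vb v≡b })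
    in a , b , c , va , vb , vc , (λ a≡b → b∉a (here (sym a≡b))) , (λ a≡c → c∉ab (here (sym a≡c)))
         , (λ b≡c → c∉ab (there (here (sym b≡c))))

  edge-outside : EdgeConn≥3 Adj → ∀ v F → length F ℕ.≤ 2 → ∃ λ a → Adj v a × (v , a) ∉ F
  edge-outside (2≤n , conn) v F |F|≤2 =
    let t , t∉ = fresh (v ∷ []) 2≤n
        a , va , _ , va∉F , _ = first-edge (conn F |F|≤2 v t) (λ v≡t → t∉ (here (sym v≡t)))
    in a , va , va∉F

  edgeConn⇒minDegree : EdgeConn≥3 Adj → MinDegree≥3 Adj
  edgeConn⇒minDegree λ≥3 v =
    let a , va , _ = edge-outside λ≥3 v [] z≤n
        b , vb , vb∉ = edge-outside λ≥3 v ((v , a) ∷ []) (s≤s z≤n)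
        c , vc , vc∉ = edge-outside λ≥3 v ((v , a) ∷ (v , b) ∷ []) (s≤s (s≤s z≤n))
    in a , b , c , va , vb , vc , (λ a≡b → vb∉ (here (cong (v ,_) (sym a≡b))))
         , (λ a≡c → vc∉ (here (cong (v ,_) (sym a≡c)))) , (λ b≡c → vc∉ (there (here (cong (v ,_) (sym b≡c)))))

  minDegree⇒4≤n : 1 ℕ.≤ n → MinDegree≥3 Adj → 4 ℕ.≤ n
  minDegree⇒4≤n 1≤n δ with δ (fromℕ< 1≤n)
  ... | a , b , c , va , vb , vc , a≢b , a≢c , b≢c =
    four-distinct⇒4≤n (irreflexive va) (irreflexive vb) (irreflexive vc) a≢b a≢c b≢c

  Avoid : Fin n → Fin n → Fin n → Set
  Avoid x y k = k ≢ x × k ≢ y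

  avoid⊎hit : ∀ x y k → Avoid x y k ⊎ (k ≡ x ⊎ k ≡ y)
  avoid⊎hit x y k with k Fin.≟ x | k Fin.≟ y
  ... | yes k≡x | _ = inj₂ (inj₁ k≡x)
  ... | no _ | yes k≡y = inj₂ (inj₂ k≡y)
  ... | no k≢x | no k≢y = inj₁ (k≢x , k≢y)

  no-three-in-pair : ∀ {x y a b c : Fin n} → a ≡ x ⊎ a ≡ y → b ≡ x ⊎ b ≡ y → c ≡ x ⊎ c ≡ y →
                     a ≢ b → a ≢ c → b ≢ c → ⊥
  no-three-in-pair (inj₁ refl) (inj₁ refl) _ a≢b _ _ = a≢b refl
  no-three-in-pair (inj₂ refl) (inj₂ refl) _ a≢b _ _ = a≢b refl
  no-three-in-pair (inj₁ refl) _ (inj₁ refl) _ a≢c _ = a≢c refl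
  no-three-in-pair (inj₂ refl) _ (inj₂ refl) _ a≢c _ = a≢c refl
  no-three-in-pair _ (inj₁ refl) (inj₁ refl) _ _ b≢c = b≢c refl
  no-three-in-pair _ (inj₂ refl) (inj₂ refl) _ _ b≢c = b≢c refl

  neighbour-avoiding : MinDegree≥3 Adj → ∀ u x y → ∃ λ b → Adj u b × Avoid x y b
  neighbour-avoiding δ u x y with δ u
  ... | a , b , c , ua , ub , uc , a≢b , a≢c , b≢c with avoid⊎hit x y a | avoid⊎hit x y b | avoid⊎hit x y c
  ... | inj₁ a-ok | _ | _ = a , ua , a-ok
  ... | inj₂ _ | inj₁ b-ok | _ = b , ub , b-ok
  ... | inj₂ _ | inj₂ _ | inj₁ c-ok = c , uc , c-ok
  ... | inj₂ a-hit | inj₂ b-hit | inj₂ c-hit = ⊥-elim (no-three-in-pair a-hit b-hit c-hit a≢b a≢c b≢c)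

  AvoidEdges : List (Fin n × Fin n) → Fin n → Fin n → Set
  AvoidEdges F x y = ((x , y) ∉ F) × ((y , x) ∉ F)

  BlockedBy : List (Fin n) → Fin n × Fin n → Set
  BlockedBy S (a , b) = a ∈ S ⊎ b ∈ S ⊎ a ≡ b

  blockedBy-weaken : ∀ {S S′ e} → (∀ {k} → k ∈ S → k ∈ S′) → BlockedBy S e → BlockedBy S′ e
  blockedBy-weaken S⊆S′ (inj₁ a∈S) = inj₁ (S⊆S′ a∈S)
  blockedBy-weaken S⊆S′ (inj₂ (inj₁ b∈S)) = inj₂ (inj₁ (S⊆S′ b∈S))
  blockedBy-weaken S⊆S′ (inj₂ (inj₂ a≡b)) = inj₂ (inj₂ a≡b)

  -- Loops are never edges, and every other blocked pair has an endpoint in S.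
  avoid-blocked : ∀ {F S u v} → (∀ e → e ∈ F → BlockedBy S e) → u ∉ S →
                  Walk Adj (_∉ S) (λ _ _ → ⊤) u v → Walk Adj (λ _ → ⊤) (AvoidEdges F) u v
  avoid-blocked blocked u∉S here = here
  avoid-blocked {F} {S} {u} blocked u∉S (step {v = m} um _ m∉S p) =
    step um (um∉F , mu∉F) tt (avoid-blocked blocked m∉S p)
    where
    um∉F : (u , m) ∉ F
    um∉F um∈F with blocked _ um∈F
    ... | inj₁ u∈S = u∉S u∈S
    ... | inj₂ (inj₁ m∈S) = m∉S m∈S
    ... | inj₂ (inj₂ u≡m) = irreflexive um u≡m
    mu∉F : (m , u) ∉ F
    mu∉F mu∈F with blocked _ mu∈F
    ... | inj₁ m∈S = m∉S m∈S
    ... | inj₂ (inj₁ u∈S) = u∉S u∈S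
    ... | inj₂ (inj₂ m≡u) = irreflexive um (sym m≡u)

  IsPair : Fin n → Fin n → Fin n × Fin n → Set
  IsPair u v (a , b) = (a ≡ u × b ≡ v) ⊎ (a ≡ v × b ≡ u)

  record Blocker (u v : Fin n) (e : Fin n × Fin n) : Set where
    field
      set    : List (Fin n)
      small  : length set ℕ.≤ 1
      u∉     : u ∉ set
      v∉     : v ∉ set
      blocks : BlockedBy set e

  open Blocker

  singleton-blocker : ∀ {u v e k} → Avoid u v k → BlockedBy (k ∷ []) e → Blocker u v e
  singleton-blocker (k≢u , k≢v) blocks = record
    { set = _ ∷ [] ; small = s≤s z≤n ; blocks = blocks
    ; u∉ = λ { (here u≡k) → k≢u (sym u≡k) } ; v∉ = λ { (here v≡k) → k≢v (sym v≡k) } }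
  loop-blocker : ∀ {u v a} → Blocker u v (a , a)
  loop-blocker = record { set = [] ; small = z≤n ; u∉ = λ () ; v∉ = λ () ; blocks = inj₂ (inj₂ refl) }

  blocker-or-pair : ∀ u v e → Blocker u v e ⊎ IsPair u v e
  blocker-or-pair u v (a , b) with avoid⊎hit u v a | avoid⊎hit u v b
  ... | inj₁ a-ok | _ = inj₁ (singleton-blocker a-ok (inj₁ (here refl)))
  ... | inj₂ _ | inj₁ b-ok = inj₁ (singleton-blocker b-ok (inj₂ (inj₁ (here refl))))
  ... | inj₂ (inj₁ refl) | inj₂ (inj₁ refl) = inj₁ loop-blocker
  ... | inj₂ (inj₂ refl) | inj₂ (inj₂ refl) = inj₁ loop-blocker
  ... | inj₂ (inj₁ refl) | inj₂ (inj₂ refl) = inj₂ (inj₁ (refl , refl))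
  ... | inj₂ (inj₂ refl) | inj₂ (inj₁ refl) = inj₂ (inj₂ (refl , refl))

  within-two : ∀ {A : Set} (d : A) (F : List A) → length F ℕ.≤ 2 →
               ∃₂ λ e₁ e₂ → ∀ e → e ∈ F → e ≡ e₁ ⊎ e ≡ e₂
  within-two d [] _ = d , d , λ _ ()
  within-two d (e₁ ∷ []) _ = e₁ , e₁ , λ { _ (here e≡e₁) → inj₁ e≡e₁ }
  within-two d (e₁ ∷ e₂ ∷ []) _ =
    e₁ , e₂ , λ { _ (here e≡e₁) → inj₁ e≡e₁ ; _ (there (here e≡e₂)) → inj₂ e≡e₂ }
  within-two d (_ ∷ _ ∷ _ ∷ _) (s≤s (s≤s ()))

  module _ (κ : VertexConn≥3 Adj) where

    walk-avoiding-blocked : ∀ {F u v} S → length S ℕ.≤ 2 → u ∉ S → v ∉ S → (∀ e → e ∈ F → BlockedBy S e) →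
                            Walk Adj (λ _ → ⊤) (AvoidEdges F) u v
    walk-avoiding-blocked {u = u} {v} S |S|≤2 u∉S v∉S blocked =
      avoid-blocked blocked u∉S (proj₂ κ S |S|≤2 u v u∉S v∉S)

    -- The deleted edges other than uv are blocked by S: leave u along an
    -- edge uw with w ∉ S ∪ {v}, and then avoid u as well.
    detour : ∀ {F u v} → u ≢ v → ∀ S → length S ℕ.≤ 1 → u ∉ S → v ∉ S →
             (∀ e → e ∈ F → BlockedBy S e ⊎ IsPair u v e) → Walk Adj (λ _ → ⊤) (AvoidEdges F) u v
    detour {F} {u} {v} u≢v S |S|≤1 u∉S v∉S blocked-or-uv with neighbour-outside κ u (v ∷ S) (s≤s |S|≤1) u∉vS
      where
      u∉vS : u ∉ v ∷ S
      u∉vS (here u≡v) = u≢v u≡v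
      u∉vS (there u∈S) = u∉S u∈S
    ... | w , uw , w∉vS = step uw (uw∉F , wu∉F) tt
      (walk-avoiding-blocked (u ∷ S) (s≤s |S|≤1) w∉uS v∉uS blocked)
      where
      w≢v : w ≢ v
      w≢v w≡v = w∉vS (here w≡v)
      w∉S : w ∉ S
      w∉S w∈S = w∉vS (there w∈S)
      w∉uS : w ∉ u ∷ S
      w∉uS (here w≡u) = irreflexive uw (sym w≡u)
      w∉uS (there w∈S) = w∉S w∈S
      v∉uS : v ∉ u ∷ S
      v∉uS (here v≡u) = u≢v (sym v≡u)
      v∉uS (there v∈S) = v∉S v∈S
      blocked : ∀ e → e ∈ F → BlockedBy (u ∷ S) e
      blocked e e∈F with blocked-or-uv e e∈F
      ... | inj₁ e-blocked = blockedBy-weaken there e-blocked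
      ... | inj₂ (inj₁ (refl , _)) = inj₁ (here refl)
      ... | inj₂ (inj₂ (_ , refl)) = inj₂ (inj₁ (here refl))
      uw∉F : (u , w) ∉ F
      uw∉F uw∈F with blocked-or-uv _ uw∈F
      ... | inj₁ (inj₁ u∈S) = u∉S u∈S
      ... | inj₁ (inj₂ (inj₁ w∈S)) = w∉S w∈S
      ... | inj₁ (inj₂ (inj₂ u≡w)) = irreflexive uw u≡w
      ... | inj₂ (inj₁ (_ , w≡v)) = w≢v w≡v
      ... | inj₂ (inj₂ (u≡v , _)) = u≢v u≡v
      wu∉F : (w , u) ∉ F
      wu∉F wu∈F with blocked-or-uv _ wu∈F
      ... | inj₁ (inj₁ w∈S) = w∉S w∈S
      ... | inj₁ (inj₂ (inj₁ u∈S)) = u∉S u∈S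
      ... | inj₁ (inj₂ (inj₂ w≡u)) = irreflexive uw (sym w≡u)
      ... | inj₂ (inj₁ (_ , u≡v)) = u≢v u≡v
      ... | inj₂ (inj₂ (w≡v , _)) = w≢v w≡v

    vertexConn⇒edgeConn : EdgeConn≥3 Adj
    vertexConn⇒edgeConn = ℕ.≤-trans (s≤s (s≤s z≤n)) (proj₁ κ) , connected
      where
      connected : ∀ F → length F ℕ.≤ 2 → ∀ u v → Walk Adj (λ _ → ⊤) (AvoidEdges F) u v
      connected F |F|≤2 u v with u Fin.≟ v
      ... | yes refl = here
      ... | no u≢v with within-two (u , u) F |F|≤2
      ... | e₁ , e₂ , F⊆ with blocker-or-pair u v e₁ | blocker-or-pair u v e₂
      ... | inj₁ B₁ | inj₁ B₂ = walk-avoiding-blocked (set B₁ ++ set B₂)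
            (ℕ.≤-trans (ℕ.≤-reflexive (length-++ (set B₁))) (ℕ.+-mono-≤ (small B₁) (small B₂)))
            (λ u∈ → [ u∉ B₁ , u∉ B₂ ]′ (∈-++⁻ (set B₁) u∈)) (λ v∈ → [ v∉ B₁ , v∉ B₂ ]′ (∈-++⁻ (set B₁) v∈))
            λ e e∈F → [ (λ { refl → blockedBy-weaken ∈-++⁺ˡ (blocks B₁) })
                      , (λ { refl → blockedBy-weaken (∈-++⁺ʳ (set B₁)) (blocks B₂) }) ]′ (F⊆ e e∈F)
      ... | inj₁ B₁ | inj₂ P₂ = detour u≢v (set B₁) (small B₁) (u∉ B₁) (v∉ B₁)
            λ e e∈F → [ (λ { refl → inj₁ (blocks B₁) }) , (λ { refl → inj₂ P₂ }) ]′ (F⊆ e e∈F)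
      ... | inj₂ P₁ | inj₁ B₂ = detour u≢v (set B₂) (small B₂) (u∉ B₂) (v∉ B₂)
            λ e e∈F → [ (λ { refl → inj₂ P₁ }) , (λ { refl → inj₁ (blocks B₂) }) ]′ (F⊆ e e∈F)
      ... | inj₂ P₁ | inj₂ P₂ = detour u≢v [] z≤n (λ ()) (λ ())
            λ e e∈F → [ (λ { refl → inj₂ P₁ }) , (λ { refl → inj₂ P₂ }) ]′ (F⊆ e e∈F)

  avoiding-pairs⇒vertexConn : 4 ℕ.≤ n →
    (∀ x y u v → Avoid x y u → Avoid x y v → Walk Adj (Avoid x y) (λ _ _ → ⊤) u v) → VertexConn≥3 Adj
  avoiding-pairs⇒vertexConn 4≤n walk = 4≤n , connected
    where
    avoiding-pair : ∀ x y u v → u ∉ x ∷ y ∷ [] → v ∉ x ∷ y ∷ [] → Walk Adj (_∉ x ∷ y ∷ []) (λ _ _ → ⊤) u v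
    avoiding-pair x y u v u∉ v∉ = mapᵛ (λ _ → ∉pair) (walk x y u v (avoid u∉) (avoid v∉))
      where
      avoid : ∀ {k} → k ∉ x ∷ y ∷ [] → Avoid x y k
      avoid k∉ = (λ k≡x → k∉ (here k≡x)) , (λ k≡y → k∉ (there (here k≡y)))
      ∉pair : ∀ {k} → Avoid x y k → k ∉ x ∷ y ∷ []
      ∉pair (k≢x , _) (here k≡x) = k≢x k≡x
      ∉pair (_ , k≢y) (there (here k≡y)) = k≢y k≡y
    ∉[x]⇒∉[x,x] : ∀ {x k} → k ∉ x ∷ [] → k ∉ x ∷ x ∷ []
    ∉[x]⇒∉[x,x] k∉ (here k≡x) = k∉ (here k≡x)
    ∉[x]⇒∉[x,x] k∉ (there k∈) = k∉ k∈
    connected : ∀ S → length S ℕ.≤ 2 → ∀ u v → u ∉ S → v ∉ S → Walk Adj (_∉ S) (λ _ _ → ⊤) u v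
    connected [] _ u v _ _ with fresh (u ∷ v ∷ []) (ℕ.≤-trans (s≤s (s≤s (s≤s z≤n))) 4≤n)
    ... | x , x∉ = mapᵛ (λ _ _ ()) (avoiding-pair x x u v (∉[x]⇒∉[x,x] u∉[x]) (∉[x]⇒∉[x,x] v∉[x]))
      where
      u∉[x] : u ∉ x ∷ []
      u∉[x] (here refl) = x∉ (here refl)
      v∉[x] : v ∉ x ∷ []
      v∉[x] (here refl) = x∉ (there (here refl))
    connected (x ∷ []) _ u v u∉ v∉ = mapᵛ (λ _ k∉ k∈ → k∉ (there k∈))
      (avoiding-pair x x u v (∉[x]⇒∉[x,x] u∉) (∉[x]⇒∉[x,x] v∉))
    connected (x ∷ y ∷ []) _ u v u∉ v∉ = avoiding-pair x y u v u∉ v∉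
    connected (_ ∷ _ ∷ _ ∷ _) (s≤s (s≤s ()))

count : ∀ {m} {P : Fin m → Set} → (∀ k → Dec (P k)) → ℕ
count {ℕ.zero} P? = 0
count {ℕ.suc m} P? with P? zero
... | yes _ = ℕ.suc (count (P? ∘ suc))
... | no _ = count (P? ∘ suc)

count-mono : ∀ {m} {P Q : Fin m → Set} (P? : ∀ k → Dec (P k)) (Q? : ∀ k → Dec (Q k)) →
             (∀ k → P k → Q k) → count P? ℕ.≤ count Q?
count-mono {ℕ.zero} P? Q? P⊆Q = z≤n
count-mono {ℕ.suc m} P? Q? P⊆Q with P? zero | Q? zero
... | yes _ | yes _ = s≤s (count-mono (P? ∘ suc) (Q? ∘ suc) (P⊆Q ∘ suc))
... | yes p₀ | no ¬q₀ = ⊥-elim (¬q₀ (P⊆Q zero p₀))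
... | no _ | yes _ = ℕ.m≤n⇒m≤1+n (count-mono (P? ∘ suc) (Q? ∘ suc) (P⊆Q ∘ suc))
... | no _ | no _ = count-mono (P? ∘ suc) (Q? ∘ suc) (P⊆Q ∘ suc)

count-< : ∀ {m} {P Q : Fin m → Set} (P? : ∀ k → Dec (P k)) (Q? : ∀ k → Dec (Q k)) →
          (∀ k → P k → Q k) → ∀ c → Q c → ¬ P c → count P? ℕ.< count Q?
count-< {ℕ.suc m} P? Q? P⊆Q c qc ¬pc with P? zero | Q? zero
... | yes p₀ | no ¬q₀ = ⊥-elim (¬q₀ (P⊆Q zero p₀))
count-< P? Q? P⊆Q zero qc ¬pc | yes p₀ | yes _ = ⊥-elim (¬pc p₀)
count-< P? Q? P⊆Q (suc c) qc ¬pc | yes _ | yes _ = s≤s (count-< (P? ∘ suc) (Q? ∘ suc) (P⊆Q ∘ suc) c qc ¬pc)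
count-< P? Q? P⊆Q zero qc ¬pc | no _ | yes _ = s≤s (count-mono (P? ∘ suc) (Q? ∘ suc) (P⊆Q ∘ suc))
count-< P? Q? P⊆Q (suc c) qc ¬pc | no _ | yes _ = ℕ.m≤n⇒m≤1+n (count-< (P? ∘ suc) (Q? ∘ suc) (P⊆Q ∘ suc) c qc ¬pc)
count-< P? Q? P⊆Q zero qc ¬pc | no _ | no ¬q₀ = ⊥-elim (¬q₀ qc)
count-< P? Q? P⊆Q (suc c) qc ¬pc | no _ | no _ = count-< (P? ∘ suc) (Q? ∘ suc) (P⊆Q ∘ suc) c qc ¬pc

module VisibilityGraph (R : CompleteOrderedField) {n : ℕ} (p : Fin n → Point R)
                       (p-injective : Injective _≡_ _≡_ p) where

  open PlaneGeometry R
  open GraphProperties (VisAdj R p) proj₁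
    using (_++ʷ_; mapᵛ; Avoid; avoid⊎hit; neighbour-avoiding; minDegree⇒4≤n; avoiding-pairs⇒vertexConn)

  Visible : Fin n → Fin n → Set
  Visible = VisAdj R p

  Between : Fin n → Fin n → Fin n → Set
  Between i j k = p k ∈⦅ p i , p j ⦆

  p-≢ : ∀ {i j} → i ≢ j → p i ≢ p j
  p-≢ i≢j pi≡pj = i≢j (p-injective pi≡pj)

  between? : ∀ {i j} → i ≢ j → ∀ k → Dec (Between i j k)
  between? i≢j k = ∈⦅⦆? (p-≢ i≢j) (p k)

  between⇒≢ : ∀ {u v k} → Between u v k → k ≢ u → u ≢ v
  between⇒≢ k∈uu k≢u refl = k≢u (p-injective (∈⦅a,a⦆⇒≡a k∈uu))

  visible-sym : ∀ {i j} → Visible i j → Visible j i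
  visible-sym (i≢j , clear) = (λ j≡i → i≢j (sym j≡i)) , λ k k∈ji → clear k (∈⦅⦆-sym k∈ji)

  reverse : ∀ {V u v} → V u → Walk Visible V (λ _ _ → ⊤) u v → Walk Visible V (λ _ _ → ⊤) v u
  reverse Vu here = here
  reverse Vu (step uw _ Vw q) = reverse Vw q ++ʷ step (visible-sym uw) tt Vu here

  -- Induction on the number of points strictly between i and j: if one,
  -- k, exists, both (i,k) and (k,j) contain fewer.
  walk-along : ∀ {V} i j → V j → (∀ k → Between i j k → V k) → Walk Visible V (λ _ _ → ⊤) i j
  walk-along {V} i j Vj ok with i Fin.≟ j
  ... | yes refl = here
  ... | no i≢j = go _ i j i≢j ℕ.≤-refl Vj ok
    where
    go : ∀ m i j (i≢j : i ≢ j) → count (between? i≢j) ℕ.< m → V j → (∀ k → Between i j k → V k) →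
         Walk Visible V (λ _ _ → ⊤) i j
    go (ℕ.suc m) i j i≢j (s≤s c≤m) Vj ok with Fin.any? (between? i≢j)
    ... | no nothing-between = step (i≢j , λ k k∈ij → nothing-between (k , k∈ij)) tt Vj here
    ... | yes (k , k∈ij) =
      go m i k i≢k (ℕ.<-≤-trans fewer-ik c≤m) (ok k k∈ij) (λ r r∈ik → ok r (∈⦅⦆-shrinkʳ k∈ij r∈ik))
        ++ʷ go m k j k≢j (ℕ.<-≤-trans fewer-kj c≤m) Vj (λ r r∈kj → ok r (∈⦅⦆-shrinkˡ k∈ij r∈kj))
      where
      i≢k : i ≢ k
      i≢k i≡k = ∈⦅⦆⇒≢ˡ k∈ij (p-≢ i≢j) (cong p (sym i≡k))
      k≢j : k ≢ j
      k≢j k≡j = ∈⦅⦆⇒≢ʳ k∈ij (p-≢ i≢j) (cong p k≡j)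
      fewer-ik = count-< (between? i≢k) (between? i≢j) (λ r → ∈⦅⦆-shrinkʳ k∈ij) k k∈ij
                         (λ k∈ik → ∈⦅⦆⇒≢ʳ k∈ik (p-≢ i≢k) refl)
      fewer-kj = count-< (between? k≢j) (between? i≢j) (λ r → ∈⦅⦆-shrinkˡ k∈ij) k k∈ij
                         (λ k∈kj → ∈⦅⦆⇒≢ˡ k∈kj (p-≢ k≢j) refl)

  module _ {u v : Fin n} (pu≢pv : p u ≢ p v) where

    OnLine : Fin n → Set
    OnLine k = Collinear (p u) (p v) (p k)

    pos : Fin n → Carrier
    pos k = param pu≢pv (p k)

    pos-injective : ∀ {i j} → OnLine i → OnLine j → i ≢ j → pos i ≢ pos j
    pos-injective i-on j-on i≢j eq = i≢j (p-injective (param-injective pu≢pv i-on j-on eq))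

    -- The nearer of two points of the line beyond e blocks the farther one.
    beyond-extreme-blocked : ∀ {e} → OnLine e → (∀ k → OnLine k → pos e ≤ᵣ pos k) →
                             ∀ {i j} → Visible e i → Visible e j → OnLine i → OnLine j → pos i < pos j → ⊥
    beyond-extreme-blocked {e} e-on e-min {i} ei ej i-on j-on i<j with e-min i i-on
    ... | inj₁ e<i = proj₂ ej i (collinear-ordered⇒∈⦅⦆ pu≢pv e-on i-on j-on e<i i<j)
    ... | inj₂ e≡i = pos-injective e-on i-on (proj₁ ei) e≡i

    extreme-sees-at-most-one : ∀ {e} → OnLine e → (∀ k → OnLine k → pos e ≤ᵣ pos k) →
                               ∀ {i j} → Visible e i → Visible e j → OnLine i → OnLine j → i ≢ j → ⊥
    extreme-sees-at-most-one e-on e-min {i} {j} ei ej i-on j-on i≢j with <-trichotomy (pos i) (pos j)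
    ... | inj₁ i<j = beyond-extreme-blocked e-on e-min ei ej i-on j-on i<j
    ... | inj₂ (inj₁ i≡j) = pos-injective i-on j-on i≢j i≡j
    ... | inj₂ (inj₂ j<i) = beyond-extreme-blocked e-on e-min ej ei j-on i-on j<i

  module _ (δ : MinDegree≥3 Visible) where

    -- Apply extreme-sees-at-most-one to the point of the line with the least
    -- parameter: at most one of its three neighbours is off the line.
    not-collinear-but-one : ∀ {u v} (pu≢pv : p u ≢ p v) y → ¬ (∀ k → OnLine pu≢pv k ⊎ k ≡ y)
    not-collinear-but-one {u} {v} pu≢pv y on-line-or-y
      with minimum (OnLine pu≢pv) (λ k → orient (p u) (p v) (p k) ≟ 0#) (pos pu≢pv)
    ... | inj₁ none = none u (collinear-start (p u) (p v))
    ... | inj₂ (e , e-on , e-min) with δ e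
    ... | a , b , c , ea , eb , ec , a≢b , a≢c , b≢c
      with on-line-or-y a | on-line-or-y b | on-line-or-y c
    ... | inj₁ a-on | inj₁ b-on | _ = extreme-sees-at-most-one pu≢pv e-on e-min ea eb a-on b-on a≢b
    ... | inj₁ a-on | inj₂ refl | inj₁ c-on = extreme-sees-at-most-one pu≢pv e-on e-min ea ec a-on c-on a≢c
    ... | inj₂ refl | inj₁ b-on | inj₁ c-on = extreme-sees-at-most-one pu≢pv e-on e-min eb ec b-on c-on b≢c
    ... | inj₁ _ | inj₂ refl | inj₂ refl = b≢c refl
    ... | inj₂ refl | inj₂ refl | _ = a≢b refl
    ... | inj₂ refl | inj₁ _ | inj₂ refl = a≢c refl

    module AvoidingPair (x y : Fin n) where

      AvoidingWalk : Fin n → Fin n → Set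
      AvoidingWalk = Walk Visible (Avoid x y) (λ _ _ → ⊤)

      walk-along-avoiding : ∀ i j → Avoid x y j → ¬ Between i j x → ¬ Between i j y → AvoidingWalk i j
      walk-along-avoiding i j j-ok x∉ij y∉ij = walk-along i j j-ok
        λ k k∈ij → (λ { refl → x∉ij k∈ij }) , (λ { refl → y∉ij k∈ij })

      -- Leave u towards a neighbour b ∉ {x,y}; from b, go to v directly or via w.
      around-y : ∀ u v w → Avoid x y u → Avoid x y v → Avoid x y w → Between u v x →
                 ¬ Collinear (p u) (p v) (p w) → Between u w y → AvoidingWalk u v
      around-y u v w u-ok v-ok w-ok x∈uv w-off y∈uw =
        let b , ub , b-ok = neighbour-avoiding δ u x y in via b ub b-ok
        where
        u≢v : u ≢ v
        u≢v = between⇒≢ x∈uv (λ x≡u → proj₁ u-ok (sym x≡u))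
        u-on = collinear-start (p u) (p v)
        v-on = collinear-end (p u) (p v)
        x-on = ∈⦅⦆⇒collinear x∈uv
        y-off : ¬ Collinear (p u) (p v) (p y)
        y-off y-on = let t , 0<t , _ , y≡tw = orient-∈⦅⦆-from-line y∈uw u-on in
          [ 0<⇒≢0 0<t , w-off ]′ (x*y≡0⇒x≡0⊎y≡0 (trans (sym y≡tw) y-on))
        w→v : AvoidingWalk w v
        w→v = walk-along-avoiding w v v-ok
          (λ x∈wv → w-off (collinear-∈⦅⦆ˡ x∈wv x-on v-on))
          (λ y∈wv → u≢v (sym (p-injective (central-projection-injective v-on u-on w-off (∈⦅⦆-sym y∈wv) y∈uw))))
        via-w : ∀ {b} → Visible u b → Avoid x y b → ¬ Between b w x → ¬ Between b w y → AvoidingWalk u v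
        via-w {b} ub b-ok x∉bw y∉bw = step ub tt b-ok (walk-along-avoiding b w w-ok x∉bw y∉bw ++ʷ w→v)
        via : ∀ b → Visible u b → Avoid x y b → AvoidingWalk u v
        via b ub b-ok with orient (p u) (p v) (p b) ≟ 0#
        ... | yes b-on = via-w ub b-ok
          (λ x∈bw → w-off (collinear-∈⦅⦆ʳ x∈bw x-on b-on))
          (λ y∈bw → proj₁ ub (sym (p-injective (central-projection-injective b-on u-on w-off y∈bw y∈uw))))
        ... | no b-off with between? (λ { refl → b-off v-on }) y
        ...   | no y∉bv = step ub tt b-ok (walk-along-avoiding b v v-ok
                            (λ x∈bv → b-off (collinear-∈⦅⦆ˡ x∈bv x-on v-on)) y∉bv)
        ...   | yes y∈bv = via-w ub b-ok
                  (λ x∈bw → sameSide⇒∈⦅⦆-off-line (crossing⇒sameSide y∈uw (∈⦅⦆-sym y∈bv) w-off) x∈bw x-on)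
                  (λ y∈bw → y-off (concurrent⇒collinear y∈uw y∈bw y∈bv (p-≢ (λ y≡w → proj₂ w-ok (sym y≡w)))))

      -- Some w ∉ {x,y} lies off the line uv, as otherwise every point but y
      -- would be on it; go around x through w.
      around-x : ∀ u v → Avoid x y u → Avoid x y v → Between u v x → AvoidingWalk u v
      around-x u v u-ok v-ok x∈uv = go (Fin.any? λ k → avoid? k ×-dec ¬? (orient (p u) (p v) (p k) ≟ 0#))
        where
        u≢v = between⇒≢ x∈uv (λ x≡u → proj₁ u-ok (sym x≡u))
        u-on = collinear-start (p u) (p v)
        v-on = collinear-end (p u) (p v)
        x-on = ∈⦅⦆⇒collinear x∈uv
        avoid? : ∀ k → Dec (Avoid x y k)
        avoid? k = ¬? (k Fin.≟ x) ×-dec ¬? (k Fin.≟ y)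
        through : ∀ w → Avoid x y w → ¬ Collinear (p u) (p v) (p w) → AvoidingWalk u v
        through w w-ok w-off with between? (λ { refl → w-off u-on }) y | between? (λ { refl → w-off v-on }) y
        ... | yes y∈uw | _ = around-y u v w u-ok v-ok w-ok x∈uv w-off y∈uw
        ... | no _ | yes y∈wv = reverse v-ok
              (around-y v u w v-ok u-ok w-ok (∈⦅⦆-sym x∈uv) (w-off ∘ collinear-swap) (∈⦅⦆-sym y∈wv))
        ... | no y∉uw | no y∉wv =
              walk-along-avoiding u w w-ok (λ x∈uw → w-off (collinear-∈⦅⦆ʳ x∈uw x-on u-on)) y∉uw
                ++ʷ walk-along-avoiding w v v-ok (λ x∈wv → w-off (collinear-∈⦅⦆ˡ x∈wv x-on v-on)) y∉wv
        on-line-or-y : ¬ (∃ λ k → Avoid x y k × ¬ Collinear (p u) (p v) (p k)) → ∀ k → OnLine (p-≢ u≢v) k ⊎ k ≡ y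
        on-line-or-y none k with avoid⊎hit x y k
        ... | inj₂ (inj₁ refl) = inj₁ x-on
        ... | inj₂ (inj₂ k≡y) = inj₂ k≡y
        ... | inj₁ k-ok with orient (p u) (p v) (p k) ≟ 0#
        ...   | yes k-on = inj₁ k-on
        ...   | no k-off = ⊥-elim (none (k , k-ok , k-off))
        go : Dec (∃ λ k → Avoid x y k × ¬ Collinear (p u) (p v) (p k)) → AvoidingWalk u v
        go (yes (w , w-ok , w-off)) = through w w-ok w-off
        go (no none) = ⊥-elim (not-collinear-but-one (p-≢ u≢v) y (on-line-or-y none))

    avoiding-walk : ∀ x y u v → Avoid x y u → Avoid x y v → Walk Visible (Avoid x y) (λ _ _ → ⊤) u v
    avoiding-walk x y u v u-ok v-ok with u Fin.≟ v
    ... | yes refl = here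
    ... | no u≢v with between? u≢v x | between? u≢v y
    ... | yes x∈uv | _ = AvoidingPair.around-x x y u v u-ok v-ok x∈uv
    ... | no _ | yes y∈uv = mapᵛ (λ _ → swap) (AvoidingPair.around-x y x u v (swap u-ok) (swap v-ok) y∈uv)
    ... | no x∉uv | no y∉uv = AvoidingPair.walk-along-avoiding x y u v v-ok x∉uv y∉uv

  minDegree⇒vertexConn : 1 ℕ.≤ n → MinDegree≥3 Visible → VertexConn≥3 Visible
  minDegree⇒vertexConn 1≤n δ = avoiding-pairs⇒vertexConn (minDegree⇒4≤n 1≤n δ) (avoiding-walk δ)

proposition13 : (R : CompleteOrderedField) (n : ℕ) (p : Fin n → Point R) →
    Injective _≡_ _≡_ p → 1 ≤ n →
    (VertexConn≥3 (VisAdj R p) ⇔ EdgeConn≥3 (VisAdj R p)) ×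
    (EdgeConn≥3 (VisAdj R p) ⇔ MinDegree≥3 (VisAdj R p))
proposition13 R n p p-injective 1≤n =
  mk⇔ vertexConn⇒edgeConn (minDegree⇒vertexConn 1≤n ∘ edgeConn⇒minDegree) ,
  mk⇔ edgeConn⇒minDegree (vertexConn⇒edgeConn ∘ minDegree⇒vertexConn 1≤n)
  where
  open GraphProperties (VisAdj R p) proj₁
  open VisibilityGraph R p p-injective using (minDegree⇒vertexConn)
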